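{- For all integers $n,k\geq 0$, $$A_{n+k,k}=\sum_{r=0}^{n}\sum_{j=0}^{k}\binom{n}{r}V_{r}S(k,j)j^{n-r},\qquad A_{n+k,k}=\sum_{r=0}^{n}\sum_{j=0}^{k}\binom{n}{r}B_{r}S(k,j)(j-1)^{n-r}.$$
   Context: A partition of a finite set is a collection of nonempty, pairwise disjoint subsets (blocks) whose union is the set; a singleton of a partition is a block with exactly one element. $S(k,j)$ is the Stirling number of the second kind (number of partitions of $\{1,\dots,k\}$ into exactly $j$ blocks; $S(0,0)=1$). $B_n$ denotes the $n$-th Bell number ($B_0=1$), and $V_n$ the number of partitions of $\{1,\dots,n\}$ with no singletons ($V_0=1$). For integers $0\leq k\leq n$, $A_{n,k}$ denotes the number of partitions of $\{1,2,\dots,n+1\}$ whose largest singleton is $k+1$ (i.e. $\{k+1\}$ is a block and no $j>k+1$ forms a singleton block). The convention $0^0=1$ is used. -}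

module Defs where

open import Data.Bool using (Bool; true; false; not; _∧_; _∨_; if_then_else_)
open import Data.Nat using (ℕ; zero; suc; _+_; _≡ᵇ_; _<ᵇ_)
open import Data.Fin using (Fin; toℕ)
open import Data.Fin.Subset using (Subset; ⁅_⁆)
open import Data.Vec using (Vec; []; _∷_; lookup)
open import Data.Vec.Properties using (≡-dec)
open import Data.List using (List; []; _∷_; [_]; map; _++_; length; filterᵇ; allFin; cartesianProduct)
open import Data.Bool.ListAction using (all; any)
open import Data.Product using (_×_; _,_)
open import Relation.Nullary using (does)
import Data.Bool.Properties as BoolP
import Data.Integer as ℤ

sumTo : ℕ → (ℕ → ℕ) → ℕ
sumTo zero    f = f 0
sumTo (suc n) f = sumTo n f + f (suc n)

sumToℤ : ℕ → (ℕ → ℤ.ℤ) → ℤ.ℤ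
sumToℤ zero    f = f 0
sumToℤ (suc n) f = sumToℤ n f ℤ.+ f (suc n)

allSubsets : (m : ℕ) → List (Subset m)
allSubsets zero    = [ [] ]
allSubsets (suc m) = map (false ∷_) (allSubsets m) ++ map (true ∷_) (allSubsets m)

-- A set of subsets of Fin m, i.e. a characteristic function
-- Subset m → Bool, tabulated as a binary tree (so that there are
-- finitely many, and they can be listed).
Family : ℕ → Set
Family zero    = Bool
Family (suc m) = Family m × Family m   -- (subsets not containing 0 , subsets containing 0)

_∈F_ : {m : ℕ} → Subset m → Family m → Bool
[]          ∈F b         = b
(false ∷ s) ∈F (F₀ , F₁) = s ∈F F₀
(true ∷ s)  ∈F (F₀ , F₁) = s ∈F F₁

allFamilies : (m : ℕ) → List (Family m)
allFamilies zero    = false ∷ true ∷ []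
allFamilies (suc m) = cartesianProduct (allFamilies m) (allFamilies m)

members : {m : ℕ} → Family m → List (Subset m)
members {m} F = filterᵇ (λ B → B ∈F F) (allSubsets m)

nonemptyᵇ : {m : ℕ} → Subset m → Bool
nonemptyᵇ {m} B = any (λ i → lookup B i) (allFin m)

eqSubsetᵇ : {m : ℕ} → Subset m → Subset m → Bool
eqSubsetᵇ B C = does (≡-dec BoolP._≟_ B C)

disjointᵇ : {m : ℕ} → Subset m → Subset m → Bool
disjointᵇ {m} B C = all (λ i → not (lookup B i ∧ lookup C i)) (allFin m)

isPartition : {m : ℕ} → Family m → Bool
isPartition {m} F =
  all nonemptyᵇ (members F)
  ∧ all (λ B → all (λ C → eqSubsetᵇ B C ∨ disjointᵇ B C) (members F)) (members F)
  ∧ all (λ i → any (λ B → lookup B i) (members F)) (allFin m)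

singletonBlock : {m : ℕ} → Family m → Fin m → Bool
singletonBlock F i = ⁅ i ⁆ ∈F F

countPartitions : (m : ℕ) → (Family m → Bool) → ℕ
countPartitions m P = length (filterᵇ (λ F → isPartition F ∧ P F) (allFamilies m))

numBlocks : {m : ℕ} → Family m → ℕ
numBlocks F = length (members F)

-- The numbers of the paper.  Elements of {1,…,m} are represented by
-- Fin m, element x ↔ index x-1.

Bell : ℕ → ℕ
Bell n = countPartitions n (λ _ → true)

V : ℕ → ℕ
V n = countPartitions n (λ F → all (λ i → not (singletonBlock F i)) (allFin n))

S : ℕ → ℕ → ℕ
S k j = countPartitions k (λ F → numBlocks F ≡ᵇ j)

-- A_{n,k}: partitions of {1..n+1} whose largest singleton is k+1
-- (index k is a singleton block, no index > k is a singleton block)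
A : ℕ → ℕ → ℕ
A n k = countPartitions (suc n) (λ F →
  any (λ i → (toℕ i ≡ᵇ k) ∧ singletonBlock F i) (allFin (suc n))
  ∧ all (λ i → not ((k <ᵇ toℕ i) ∧ singletonBlock F i)) (allFin (suc n)))

module Submission where

-- Each count here is a weighted sum over the partitions of a subset U of {1, …, m}, computed by
-- choosing the block of the first element of U: it is that element together with some B ⊆ U, and
-- the other blocks partition U ∖ B. When the weight factors over the blocks, the sum depends only
-- on ∣U∣ = t and satisfies f(t + 1) = ∑_{B ⊆ {1,…,t}} c(∣B∣) f(t − ∣B∣); this gives recursions for
-- V, for S(·, j) and for the Bell numbers, and with them B_n = ∑_r C(n,r) V_r.
-- For A the same choice works while the first element precedes k + 1 (its block must avoid k + 1);
-- once k + 1 comes first it is a singleton and the rest is a partition without singletons. So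
-- A_{n+k,k} = ∑_r C(n,r) V_r T_k(n − r) with T_k(s) = ∑_j S(k,j) j^s, both sides obeying the same
-- recursion in k and being V_n at k = 0. The second formula then follows from
-- j^s = ((j − 1) + 1)^s and B_r = ∑_a C(r,a) V_a.

open import Algebra.Bundles using (CommutativeSemiring)
open import Algebra.Core using (Op₂)
open import Algebra.Structures using (IsCommutativeSemiring)
import Data.Nat.Base as ℕ
open import Data.Nat.Base using (ℕ; zero; suc; _∸_; _≤_; z≤n)
open import Data.Nat.Combinatorics using (_C_; nCk+nC[k+1]≡[n+1]C[k+1]; k>n⇒nCk≡0)
import Data.Nat.Properties as ℕ
open import Relation.Binary.PropositionalEquality using (_≡_; refl; sym; trans; cong; cong₂; module ≡-Reasoning)

-- Sums over the subsets of {1, …, s}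

module BinomialSums {a} {A : Set a} {plus times : Op₂ A} {zero# one# : A}
  (isCommutativeSemiring : IsCommutativeSemiring _≡_ plus times zero# one#) where

  private
    R : CommutativeSemiring a a
    R = record { isCommutativeSemiring = isCommutativeSemiring }
    module R = CommutativeSemiring R

  open R using (_+_; _*_; 0#; 1#; +-assoc; +-comm; +-identityʳ; *-identityˡ; distribˡ; distribʳ)

  open import Algebra.Definitions.RawSemiring R.rawSemiring public using (_×_; _^_)
  open import Algebra.Properties.Monoid.Mult R.+-monoid using (×-homo-1; ×-homo-+)
  open import Algebra.Properties.CommutativeSemigroup R.+-commutativeSemigroup using (interchange)
  open ≡-Reasoning

  -- subsetSum s g = ∑_{B ⊆ {1,…,s}} g ∣B∣ (s − ∣B∣), by deciding whether the first element is in B.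
  subsetSum : ℕ → (ℕ → ℕ → A) → A
  subsetSum zero    g = g 0 0
  subsetSum (suc s) g = subsetSum s (λ i j → g i (suc j)) + subsetSum s (λ i j → g (suc i) j)

  subsetSum-cong-on : ∀ s {f g : ℕ → ℕ → A} → (∀ i j → i ℕ.+ j ≡ s → f i j ≡ g i j) →
                      subsetSum s f ≡ subsetSum s g
  subsetSum-cong-on zero    f≡g = f≡g 0 0 refl
  subsetSum-cong-on (suc s) f≡g = cong₂ _+_
    (subsetSum-cong-on s (λ i j i+j≡s → f≡g i (suc j) (trans (ℕ.+-suc i j) (cong suc i+j≡s))))
    (subsetSum-cong-on s (λ i j i+j≡s → f≡g (suc i) j (cong suc i+j≡s)))

  subsetSum-cong : ∀ s {f g : ℕ → ℕ → A} → (∀ i j → f i j ≡ g i j) → subsetSum s f ≡ subsetSum s g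
  subsetSum-cong s f≡g = subsetSum-cong-on s (λ i j _ → f≡g i j)

  subsetSum-+ : ∀ s (f g : ℕ → ℕ → A) → subsetSum s (λ i j → f i j + g i j) ≡ subsetSum s f + subsetSum s g
  subsetSum-+ zero    f g = refl
  subsetSum-+ (suc s) f g = trans (cong₂ _+_ (subsetSum-+ s _ _) (subsetSum-+ s _ _)) (interchange _ _ _ _)

  subsetSum-* : ∀ s c (f : ℕ → ℕ → A) → subsetSum s (λ i j → c * f i j) ≡ c * subsetSum s f
  subsetSum-* zero    c f = refl
  subsetSum-* (suc s) c f = trans (cong₂ _+_ (subsetSum-* s c _) (subsetSum-* s c _)) (sym (distribˡ c _ _))

  subsetSum-*ʳ : ∀ s (f : ℕ → ℕ → A) c → subsetSum s f * c ≡ subsetSum s (λ i j → f i j * c)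
  subsetSum-*ʳ zero    f c = refl
  subsetSum-*ʳ (suc s) f c = trans (distribʳ c _ _) (cong₂ _+_ (subsetSum-*ʳ s _ c) (subsetSum-*ʳ s _ c))

  subsetSum-0 : ∀ s → subsetSum s (λ _ _ → 0#) ≡ 0#
  subsetSum-0 zero    = refl
  subsetSum-0 (suc s) = trans (cong₂ _+_ (subsetSum-0 s) (subsetSum-0 s)) (+-identityʳ 0#)

  subsetSum-flip : ∀ s (g : ℕ → ℕ → A) → subsetSum s (λ i j → g j i) ≡ subsetSum s g
  subsetSum-flip zero    g = refl
  subsetSum-flip (suc s) g = trans (cong₂ _+_ (subsetSum-flip s _) (subsetSum-flip s _)) (+-comm _ _)

  subsetSum-onlyEmpty : ∀ s (f : ℕ → ℕ → A) → (∀ i j → f (suc i) j ≡ 0#) → subsetSum s f ≡ f 0 s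
  subsetSum-onlyEmpty zero    f f-suc = refl
  subsetSum-onlyEmpty (suc s) f f-suc = begin
    subsetSum s (λ i j → f i (suc j)) + subsetSum s (λ i j → f (suc i) j)
      ≡⟨ cong₂ _+_ (subsetSum-onlyEmpty s _ (λ i j → f-suc i (suc j))) (subsetSum-cong s f-suc) ⟩
    f 0 (suc s) + subsetSum s (λ _ _ → 0#)
      ≡⟨ cong (f 0 (suc s) +_) (subsetSum-0 s) ⟩
    f 0 (suc s) + 0#
      ≡⟨ +-identityʳ _ ⟩
    f 0 (suc s) ∎

  subsetSum-subsetSum : ∀ n k (f : ℕ → ℕ → ℕ → ℕ → A) →
    subsetSum n (λ r s → subsetSum k (f r s)) ≡ subsetSum k (λ i j → subsetSum n (λ r s → f r s i j))
  subsetSum-subsetSum zero    k f = refl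
  subsetSum-subsetSum (suc n) k f =
    trans (cong₂ _+_ (subsetSum-subsetSum n k _) (subsetSum-subsetSum n k _)) (sym (subsetSum-+ k _ _))

  -- Splitting a set into (B, C, D) first as (B ∪ C, D) or first as (B, C ∪ D).
  subsetSum-assoc : ∀ t (f : ℕ → ℕ → ℕ → A) →
    subsetSum t (λ r s → subsetSum r (λ a b → f a b s)) ≡ subsetSum t (λ a j → subsetSum j (f a))
  subsetSum-assoc zero    f = refl
  subsetSum-assoc (suc t) f = begin
    subsetSum t (λ r s → subsetSum r (λ a b → f a b (suc s)))
      + subsetSum t (λ r s → subsetSum r (λ a b → f a (suc b) s) + subsetSum r (λ a b → f (suc a) b s))
      ≡⟨ cong (P +_) (subsetSum-+ t _ _) ⟩
    P + (Q + S)
      ≡⟨ cong₂ _+_ (subsetSum-assoc t _) (cong₂ _+_ (subsetSum-assoc t _) (subsetSum-assoc t _)) ⟩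
    P′ + (Q′ + S′)
      ≡⟨ sym (+-assoc P′ Q′ S′) ⟩
    (P′ + Q′) + S′
      ≡⟨ cong (_+ S′) (sym (subsetSum-+ t _ _)) ⟩
    subsetSum t (λ a j → subsetSum j (λ b s → f a b (suc s)) + subsetSum j (λ b s → f a (suc b) s)) + S′ ∎
    where
    P = subsetSum t (λ r s → subsetSum r (λ a b → f a b (suc s)))
    Q = subsetSum t (λ r s → subsetSum r (λ a b → f a (suc b) s))
    S = subsetSum t (λ r s → subsetSum r (λ a b → f (suc a) b s))
    P′ = subsetSum t (λ a j → subsetSum j (λ b s → f a b (suc s)))
    Q′ = subsetSum t (λ a j → subsetSum j (λ b s → f a (suc b) s))
    S′ = subsetSum t (λ a j → subsetSum j (f (suc a)))

  subsetSum-^ : ∀ t x → subsetSum t (λ _ j → x ^ j) ≡ (x + 1#) ^ t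
  subsetSum-^ zero    x = refl
  subsetSum-^ (suc t) x = begin
    subsetSum t (λ _ j → x * x ^ j) + subsetSum t (λ _ j → x ^ j)
      ≡⟨ cong₂ _+_ (subsetSum-* t x _) refl ⟩
    x * subsetSum t (λ _ j → x ^ j) + subsetSum t (λ _ j → x ^ j)
      ≡⟨ cong (λ y → x * y + y) (subsetSum-^ t x) ⟩
    x * (x + 1#) ^ t + (x + 1#) ^ t
      ≡⟨ cong (x * (x + 1#) ^ t +_) (sym (*-identityˡ _)) ⟩
    x * (x + 1#) ^ t + 1# * (x + 1#) ^ t
      ≡⟨ sym (distribʳ _ x 1#) ⟩
    (x + 1#) * (x + 1#) ^ t ∎

  sumUpTo : ℕ → (ℕ → A) → A
  sumUpTo zero    f = f 0
  sumUpTo (suc n) f = sumUpTo n f + f (suc n)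

  sumUpTo-cong-on : ∀ n {f g : ℕ → A} → (∀ r → r ≤ n → f r ≡ g r) → sumUpTo n f ≡ sumUpTo n g
  sumUpTo-cong-on zero    f≡g = f≡g 0 z≤n
  sumUpTo-cong-on (suc n) f≡g =
    cong₂ _+_ (sumUpTo-cong-on n (λ r r≤n → f≡g r (ℕ.m≤n⇒m≤1+n r≤n))) (f≡g (suc n) ℕ.≤-refl)

  sumUpTo-cong : ∀ n {f g : ℕ → A} → (∀ r → f r ≡ g r) → sumUpTo n f ≡ sumUpTo n g
  sumUpTo-cong n f≡g = sumUpTo-cong-on n (λ r _ → f≡g r)

  sumUpTo-+ : ∀ n (f g : ℕ → A) → sumUpTo n (λ r → f r + g r) ≡ sumUpTo n f + sumUpTo n g
  sumUpTo-+ zero    f g = refl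
  sumUpTo-+ (suc n) f g = trans (cong (_+ _) (sumUpTo-+ n f g)) (interchange _ _ _ _)

  sumUpTo-* : ∀ n c (f : ℕ → A) → sumUpTo n (λ r → c * f r) ≡ c * sumUpTo n f
  sumUpTo-* zero    c f = refl
  sumUpTo-* (suc n) c f = trans (cong (_+ _) (sumUpTo-* n c f)) (sym (distribˡ c _ _))

  sumUpTo-suc : ∀ n (f : ℕ → A) → sumUpTo (suc n) f ≡ f 0 + sumUpTo n (λ r → f (suc r))
  sumUpTo-suc zero    f = refl
  sumUpTo-suc (suc n) f = trans (cong (_+ f (suc (suc n))) (sumUpTo-suc n f)) (+-assoc _ _ _)

  sumUpTo-vanishing : ∀ d a (f : ℕ → A) → (∀ j → a ℕ.< j → f j ≡ 0#) → sumUpTo (d ℕ.+ a) f ≡ sumUpTo a f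
  sumUpTo-vanishing zero    a f f≡0 = refl
  sumUpTo-vanishing (suc d) a f f≡0 = begin
    sumUpTo (d ℕ.+ a) f + f (suc (d ℕ.+ a))
      ≡⟨ cong₂ _+_ (sumUpTo-vanishing d a f f≡0) (f≡0 _ (ℕ.s≤s (ℕ.m≤n+m a d))) ⟩
    sumUpTo a f + 0#
      ≡⟨ +-identityʳ _ ⟩
    sumUpTo a f ∎

  subsetSum-sumUpTo : ∀ s n (f : ℕ → ℕ → ℕ → A) →
    subsetSum s (λ i j → sumUpTo n (f i j)) ≡ sumUpTo n (λ l → subsetSum s (λ i j → f i j l))
  subsetSum-sumUpTo s zero    f = refl
  subsetSum-sumUpTo s (suc n) f =
    trans (subsetSum-+ s _ _) (cong (_+ subsetSum s (λ i j → f i j (suc n))) (subsetSum-sumUpTo s n f))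

  -- Pascal's rule, summed against h.
  binomialSum-suc : ∀ n (h : ℕ → ℕ → A) →
    sumUpTo (suc n) (λ r → (suc n C r) × h r (suc n ∸ r))
      ≡ sumUpTo n (λ r → (n C r) × h r (suc (n ∸ r))) + sumUpTo n (λ r → (n C r) × h (suc r) (n ∸ r))
  binomialSum-suc n h = begin
    sumUpTo (suc n) (λ r → (suc n C r) × h r (suc n ∸ r))
      ≡⟨ sumUpTo-suc n _ ⟩
    h₀ + sumUpTo n (λ r → (suc n C suc r) × h (suc r) (n ∸ r))
      ≡⟨ cong (h₀ +_) (sumUpTo-cong n pascal) ⟩
    h₀ + sumUpTo n (λ r → (n C suc r) × h (suc r) (n ∸ r) + (n C r) × h (suc r) (n ∸ r))
      ≡⟨ cong (h₀ +_) (sumUpTo-+ n _ _) ⟩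
    h₀ + (Z + Y)
      ≡⟨ sym (+-assoc h₀ Z Y) ⟩
    (h₀ + Z) + Y
      ≡⟨ cong (_+ Y) (sym (sumUpTo-suc n G)) ⟩
    sumUpTo (suc n) G + Y
      ≡⟨ cong (_+ Y) (trans (cong (sumUpTo n G +_) top) (+-identityʳ _)) ⟩
    sumUpTo n G + Y
      ≡⟨ cong (_+ Y) (sumUpTo-cong-on n (λ r r≤n → cong (λ x → (n C r) × h r x) (ℕ.+-∸-assoc 1 r≤n))) ⟩
    sumUpTo n (λ r → (n C r) × h r (suc (n ∸ r))) + Y ∎
    where
    h₀ = (suc n C 0) × h 0 (suc n)
    G : ℕ → A
    G r = (n C r) × h r (suc n ∸ r)
    Y = sumUpTo n (λ r → (n C r) × h (suc r) (n ∸ r))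
    Z = sumUpTo n (λ r → (n C suc r) × h (suc r) (n ∸ r))
    pascal : ∀ r → (suc n C suc r) × h (suc r) (n ∸ r)
                 ≡ (n C suc r) × h (suc r) (n ∸ r) + (n C r) × h (suc r) (n ∸ r)
    pascal r = trans (cong (_× h (suc r) (n ∸ r))
                           (sym (trans (ℕ.+-comm (n C suc r) (n C r)) (nCk+nC[k+1]≡[n+1]C[k+1] n r))))
                     (×-homo-+ _ (n C suc r) (n C r))
    top : G (suc n) ≡ 0#
    top = cong (_× h (suc n) (n ∸ n)) (k>n⇒nCk≡0 (ℕ.n<1+n n))

  subsetSum≡binomialSum : ∀ n (g : ℕ → ℕ → A) → subsetSum n g ≡ sumUpTo n (λ r → (n C r) × g r (n ∸ r))
  subsetSum≡binomialSum zero    g = sym (×-homo-1 (g 0 0))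
  subsetSum≡binomialSum (suc n) g =
    trans (cong₂ _+_ (subsetSum≡binomialSum n _) (subsetSum≡binomialSum n _)) (sym (binomialSum-suc n g))

open import Defs
open import Data.Bool.Base using (Bool; true; false; not; _∧_; _∨_; if_then_else_; T)
open import Data.Bool.ListAction using (all; any; and; or)
import Data.Bool.Properties as Bool
open import Data.Bool.Properties using (T-∧; T-∨; T-≡; ∧-zeroʳ; ∨-identityʳ)
open import Data.Empty using (⊥-elim)
open import Data.Fin.Base as Fin using (Fin; toℕ)
open import Data.Fin.Subset using (Subset; ⊤; ⊥; _∈_; _∉_; _⊆_; _─_; ∣_∣; Nonempty)
open import Data.Fin.Subset.Properties
  using (_⊆?_; _∈?_; ∈⊤; drop-there; p─q⊆p; x∈p∧x∉q⇒x∈p─q; ∣⊤∣≡n; ∣p∣≤n)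
open import Data.List.Base as List using (List; []; _∷_; _++_; length; filterᵇ; allFin; cartesianProduct)
import Data.List.Properties as List
open import Data.List.Membership.Propositional using (find; lose) renaming (_∈_ to _∈ˡ_)
open import Data.List.Membership.Propositional.Properties
  using (∈-allFin; ∈-map⁺; ∈-++⁺ˡ; ∈-++⁺ʳ; ∈-filter⁺; ∈-filter⁻)
import Data.List.Relation.Unary.All as All
open import Data.List.Relation.Unary.All.Properties using (all⁺; all⁻)
import Data.List.Relation.Unary.Any as Any
open import Data.List.Relation.Unary.Any.Properties using (any⁺; any⁻)
open import Data.Nat using (_+_; _*_; _^_)
open import Data.Nat.Base using (pred; _<_; s≤s; _≡ᵇ_; _<ᵇ_)
open import Data.Nat.Induction using (<-rec)
open import Data.Nat.ListAction using (sum)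
open import Data.Nat.ListAction.Properties using (sum-++)
open import Data.Product using (_×_; _,_; proj₁; proj₂; ∃-syntax)
open import Data.Sum using (_⊎_; inj₁; inj₂)
open import Data.Unit using (tt) renaming (⊤ to Unit)
open import Data.Vec.Base using ([]; _∷_; lookup; here; there)
open import Data.Vec.Properties using (≡-dec; ∷-injectiveʳ; []=⇒lookup; lookup⇒[]=)
open import Function using (_∘_; Equivalence)
open import Relation.Binary.PropositionalEquality using (subst)
open import Relation.Nullary using (¬_; Dec; does; _because_; yes; no)
open import Relation.Nullary.Decidable using (T?)
open import Relation.Nullary.Reflects using (invert)
open import Algebra.Properties.CommutativeSemigroup ℕ.+-commutativeSemigroup
  using () renaming (interchange to +-interchange)
open import Algebra.Properties.CommutativeSemigroup ℕ.*-commutativeSemigroup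
  using () renaming (x∙yz≈y∙xz to *-leftComm)

open ≡-Reasoning

-- Sums over families and over subsets

χ : Bool → ℕ
χ true  = 1
χ false = 0

χ-∧ : ∀ a b → χ (a ∧ b) ≡ χ a * χ b
χ-∧ true  b = sym (ℕ.*-identityˡ (χ b))
χ-∧ false b = refl

T-injective : ∀ {a b} → (T a → T b) → (T b → T a) → a ≡ b
T-injective {false} {false} _   _   = refl
T-injective {false} {true}  _   b⇒a = ⊥-elim (b⇒a _)
T-injective {true}  {false} a⇒b _   = ⊥-elim (a⇒b _)
T-injective {true}  {true}  _   _   = refl

T-does⁻ : ∀ {p} {P : Set p} (P? : Dec P) → T (does P?) → P
T-does⁻ (true because [p]) _ = invert [p]

T-does⁺ : ∀ {p} {P : Set p} (P? : Dec P) → P → T (does P?)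
T-does⁺ (true  because _)    _ = _
T-does⁺ (false because [¬p]) p = invert [¬p] p

sumList : ∀ {a} {A : Set a} → (A → ℕ) → List A → ℕ
sumList g = sum ∘ List.map g

length-filterᵇ : ∀ {a} {A : Set a} (p : A → Bool) xs → length (filterᵇ p xs) ≡ sumList (χ ∘ p) xs
length-filterᵇ p []       = refl
length-filterᵇ p (x ∷ xs) with p x
... | true  = cong suc (length-filterᵇ p xs)
... | false = length-filterᵇ p xs

sumList-++ : ∀ {a} {A : Set a} (g : A → ℕ) xs ys → sumList g (xs ++ ys) ≡ sumList g xs + sumList g ys
sumList-++ g xs ys = trans (cong sum (List.map-++ g xs ys)) (sum-++ (List.map g xs) _)

sumList-map : ∀ {a b} {A : Set a} {B : Set b} (g : B → ℕ) (f : A → B) xs →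
              sumList g (List.map f xs) ≡ sumList (g ∘ f) xs
sumList-map g f xs = cong sum (sym (List.map-∘ xs))

sumList-cartesianProduct : ∀ {a b} {A : Set a} {B : Set b} (g : A × B → ℕ) xs ys →
  sumList g (cartesianProduct xs ys) ≡ sumList (λ x → sumList (λ y → g (x , y)) ys) xs
sumList-cartesianProduct g []       ys = refl
sumList-cartesianProduct g (x ∷ xs) ys = trans (sumList-++ g (List.map (x ,_) ys) _)
  (cong₂ _+_ (sumList-map g (x ,_) ys) (sumList-cartesianProduct g xs ys))

sumFamilies : ∀ m → (Family m → ℕ) → ℕ
sumFamilies zero    g = g false + g true
sumFamilies (suc m) g = sumFamilies m (λ F₀ → sumFamilies m (λ F₁ → g (F₀ , F₁)))

sumSubsets : ∀ m → (Subset m → ℕ) → ℕ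
sumSubsets zero    g = g []
sumSubsets (suc m) g = sumSubsets m (λ B → g (false ∷ B)) + sumSubsets m (λ B → g (true ∷ B))

sumFamilies-cong : ∀ m {f g : Family m → ℕ} → (∀ F → f F ≡ g F) → sumFamilies m f ≡ sumFamilies m g
sumFamilies-cong zero    f≡g = cong₂ _+_ (f≡g false) (f≡g true)
sumFamilies-cong (suc m) f≡g = sumFamilies-cong m (λ F₀ → sumFamilies-cong m (λ F₁ → f≡g (F₀ , F₁)))

sumSubsets-cong : ∀ m {f g : Subset m → ℕ} → (∀ B → f B ≡ g B) → sumSubsets m f ≡ sumSubsets m g
sumSubsets-cong zero    f≡g = f≡g []
sumSubsets-cong (suc m) f≡g = cong₂ _+_ (sumSubsets-cong m (λ B → f≡g _)) (sumSubsets-cong m (λ B → f≡g _))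

sumFamilies-+ : ∀ m (f g : Family m → ℕ) → sumFamilies m (λ F → f F + g F) ≡ sumFamilies m f + sumFamilies m g
sumFamilies-+ zero    f g = +-interchange (f false) (g false) (f true) (g true)
sumFamilies-+ (suc m) f g =
  trans (sumFamilies-cong m (λ F₀ → sumFamilies-+ m _ _)) (sumFamilies-+ m _ _)

sumSubsets-+ : ∀ m (f g : Subset m → ℕ) → sumSubsets m (λ B → f B + g B) ≡ sumSubsets m f + sumSubsets m g
sumSubsets-+ zero    f g = refl
sumSubsets-+ (suc m) f g =
  trans (cong₂ _+_ (sumSubsets-+ m _ _) (sumSubsets-+ m _ _))
        (+-interchange (sumSubsets m (λ B → f (false ∷ B))) (sumSubsets m (λ B → g (false ∷ B)))
                       (sumSubsets m (λ B → f (true ∷ B))) (sumSubsets m (λ B → g (true ∷ B))))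

sumFamilies-* : ∀ m c (f : Family m → ℕ) → sumFamilies m (λ F → c * f F) ≡ c * sumFamilies m f
sumFamilies-* zero    c f = sym (ℕ.*-distribˡ-+ c (f false) (f true))
sumFamilies-* (suc m) c f =
  trans (sumFamilies-cong m (λ F₀ → sumFamilies-* m c _)) (sumFamilies-* m c _)

sumSubsets-* : ∀ m c (f : Subset m → ℕ) → sumSubsets m (λ B → c * f B) ≡ c * sumSubsets m f
sumSubsets-* zero    c f = refl
sumSubsets-* (suc m) c f =
  trans (cong₂ _+_ (sumSubsets-* m c _) (sumSubsets-* m c _)) (sym (ℕ.*-distribˡ-+ c _ _))

sumSubsets-0 : ∀ m → sumSubsets m (λ _ → 0) ≡ 0
sumSubsets-0 zero    = refl
sumSubsets-0 (suc m) = cong₂ _+_ (sumSubsets-0 m) (sumSubsets-0 m)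

sumFamilies-swap : ∀ m n (g : Family m → Family n → ℕ) →
  sumFamilies m (λ F → sumFamilies n (g F)) ≡ sumFamilies n (λ G → sumFamilies m (λ F → g F G))
sumFamilies-swap zero    n g = sym (sumFamilies-+ n (g false) (g true))
sumFamilies-swap (suc m) n g =
  trans (sumFamilies-cong m (λ F₀ → sumFamilies-swap m n _)) (sumFamilies-swap m n _)

sumFamilies-sumSubsets : ∀ m n (g : Family m → Subset n → ℕ) →
  sumFamilies m (λ F → sumSubsets n (g F)) ≡ sumSubsets n (λ B → sumFamilies m (λ F → g F B))
sumFamilies-sumSubsets zero    n g = sym (sumSubsets-+ n (g false) (g true))
sumFamilies-sumSubsets (suc m) n g =
  trans (sumFamilies-cong m (λ F₀ → sumFamilies-sumSubsets m n _)) (sumFamilies-sumSubsets m n _)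

sumFamilies≡sumList : ∀ m (g : Family m → ℕ) → sumFamilies m g ≡ sumList g (allFamilies m)
sumFamilies≡sumList zero    g = cong (g false +_) (sym (ℕ.+-identityʳ (g true)))
sumFamilies≡sumList (suc m) g = begin
  sumFamilies m (λ F₀ → sumFamilies m (λ F₁ → g (F₀ , F₁)))
    ≡⟨ sumFamilies-cong m (λ F₀ → sumFamilies≡sumList m _) ⟩
  sumFamilies m (λ F₀ → sumList (λ F₁ → g (F₀ , F₁)) (allFamilies m))
    ≡⟨ sumFamilies≡sumList m _ ⟩
  sumList (λ F₀ → sumList (λ F₁ → g (F₀ , F₁)) (allFamilies m)) (allFamilies m)
    ≡⟨ sym (sumList-cartesianProduct g (allFamilies m) (allFamilies m)) ⟩
  sumList g (allFamilies (suc m)) ∎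

sumSubsets≡sumList : ∀ m (g : Subset m → ℕ) → sumSubsets m g ≡ sumList g (allSubsets m)
sumSubsets≡sumList zero    g = sym (ℕ.+-identityʳ (g []))
sumSubsets≡sumList (suc m) g = sym (begin
  sumList g (List.map (false ∷_) (allSubsets m) ++ List.map (true ∷_) (allSubsets m))
    ≡⟨ sumList-++ g (List.map (false ∷_) (allSubsets m)) _ ⟩
  sumList g (List.map (false ∷_) (allSubsets m)) + sumList g (List.map (true ∷_) (allSubsets m))
    ≡⟨ cong₂ _+_ (sumList-map g _ (allSubsets m)) (sumList-map g _ (allSubsets m)) ⟩
  sumList (λ B → g (false ∷ B)) (allSubsets m) + sumList (λ B → g (true ∷ B)) (allSubsets m)
    ≡⟨ cong₂ _+_ (sumSubsets≡sumList m _) (sumSubsets≡sumList m _) ⟨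
  sumSubsets (suc m) g ∎)

countPartitions≡sumFamilies : ∀ m (P : Family m → Bool) →
  countPartitions m P ≡ sumFamilies m (λ F → χ (isPartition F ∧ P F))
countPartitions≡sumFamilies m P = trans (length-filterᵇ _ (allFamilies m)) (sym (sumFamilies≡sumList m _))

numBlocks≡sumSubsets : ∀ {m} (F : Family m) → numBlocks F ≡ sumSubsets m (λ B → χ (B ∈F F))
numBlocks≡sumSubsets {m} F = trans (length-filterᵇ _ (allSubsets m)) (sym (sumSubsets≡sumList m _))

sameFamily : ∀ {m} → Family m → Family m → Bool
sameFamily {zero}  true      true      = true
sameFamily {zero}  false     false     = true
sameFamily {zero}  _         _         = false
sameFamily {suc m} (F₀ , F₁) (G₀ , G₁) = sameFamily F₀ G₀ ∧ sameFamily F₁ G₁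

sameFamily-refl : ∀ {m} (F : Family m) → sameFamily F F ≡ true
sameFamily-refl {zero}  true      = refl
sameFamily-refl {zero}  false     = refl
sameFamily-refl {suc m} (F₀ , F₁) = cong₂ _∧_ (sameFamily-refl F₀) (sameFamily-refl F₁)

sameFamily-sound : ∀ {m} {F G : Family m} → T (sameFamily F G) → F ≡ G
sameFamily-sound {zero}  {true}    {true}    _ = refl
sameFamily-sound {zero}  {false}   {false}   _ = refl
sameFamily-sound {zero}  {true}    {false}   ()
sameFamily-sound {zero}  {false}   {true}    ()
sameFamily-sound {suc m} {F₀ , F₁} {G₀ , G₁} same =
  let same₀ , same₁ = Equivalence.to T-∧ same in cong₂ _,_ (sameFamily-sound same₀) (sameFamily-sound same₁)

sameSubset : ∀ {m} → Subset m → Subset m → Bool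
sameSubset []          []          = true
sameSubset (true ∷ B)  (true ∷ D)  = sameSubset B D
sameSubset (false ∷ B) (false ∷ D) = sameSubset B D
sameSubset (_ ∷ _)     (_ ∷ _)     = false

sameSubset-refl : ∀ {m} (B : Subset m) → sameSubset B B ≡ true
sameSubset-refl []          = refl
sameSubset-refl (true ∷ B)  = sameSubset-refl B
sameSubset-refl (false ∷ B) = sameSubset-refl B

sameSubset-sound : ∀ {m} {B D : Subset m} → T (sameSubset B D) → B ≡ D
sameSubset-sound {B = []}        {[]}        _    = refl
sameSubset-sound {B = true ∷ B}  {true ∷ D}  same = cong (true ∷_) (sameSubset-sound same)
sameSubset-sound {B = false ∷ B} {false ∷ D} same = cong (false ∷_) (sameSubset-sound same)
sameSubset-sound {B = true ∷ B}  {false ∷ D} ()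
sameSubset-sound {B = false ∷ B} {true ∷ D}  ()

emptyFamily : ∀ {m} → Family m
emptyFamily {zero}  = false
emptyFamily {suc m} = emptyFamily , emptyFamily

singletonFamily : ∀ {m} → Subset m → Family m
singletonFamily []          = true
singletonFamily (false ∷ B) = singletonFamily B , emptyFamily
singletonFamily (true ∷ B)  = emptyFamily , singletonFamily B

-- Meaningful only for a singleton family.
theMember : ∀ {m} → Family m → Subset m
theMember {zero}  _         = []
theMember {suc m} (F₀ , F₁) =
  if sameFamily F₁ emptyFamily then false ∷ theMember F₀ else true ∷ theMember F₁

isSingletonFamily : ∀ {m} → Family m → Bool
isSingletonFamily F = sameFamily F (singletonFamily (theMember F))

∈-emptyFamily : ∀ {m} (B : Subset m) → B ∈F emptyFamily ≡ false
∈-emptyFamily []          = refl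
∈-emptyFamily (false ∷ B) = ∈-emptyFamily B
∈-emptyFamily (true ∷ B)  = ∈-emptyFamily B

∈-singletonFamily : ∀ {m} (D B : Subset m) → D ∈F singletonFamily B ≡ sameSubset D B
∈-singletonFamily []          []          = refl
∈-singletonFamily (false ∷ D) (false ∷ B) = ∈-singletonFamily D B
∈-singletonFamily (false ∷ D) (true ∷ B)  = ∈-emptyFamily D
∈-singletonFamily (true ∷ D)  (false ∷ B) = ∈-emptyFamily D
∈-singletonFamily (true ∷ D)  (true ∷ B)  = ∈-singletonFamily D B

family-ext : ∀ {m} {F G : Family m} → (∀ B → B ∈F F ≡ B ∈F G) → F ≡ G
family-ext {zero}                        same = same []
family-ext {suc m} {F₀ , F₁} {G₀ , G₁} same =
  cong₂ _,_ (family-ext (λ B → same (false ∷ B))) (family-ext (λ B → same (true ∷ B)))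

singletonFamily≢emptyFamily : ∀ {m} (B : Subset m) → sameFamily (singletonFamily B) emptyFamily ≡ false
singletonFamily≢emptyFamily []                = refl
singletonFamily≢emptyFamily (false ∷ B)       rewrite singletonFamily≢emptyFamily B = refl
singletonFamily≢emptyFamily {suc m} (true ∷ B) rewrite singletonFamily≢emptyFamily B = ∧-zeroʳ _

theMember-singletonFamily : ∀ {m} (B : Subset m) → theMember (singletonFamily B) ≡ B
theMember-singletonFamily []                = refl
theMember-singletonFamily {suc m} (false ∷ B)
  rewrite sameFamily-refl (emptyFamily {m}) = cong (false ∷_) (theMember-singletonFamily B)
theMember-singletonFamily (true ∷ B)
  rewrite singletonFamily≢emptyFamily B     = cong (true ∷_) (theMember-singletonFamily B)

χ-∧-* : ∀ a b x → χ (a ∧ b) * x ≡ χ a * (χ b * x)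
χ-∧-* a b x = trans (cong (_* x) (χ-∧ a b)) (ℕ.*-assoc (χ a) (χ b) x)

sumFamilies-δ : ∀ m (G : Family m) (h : Family m → ℕ) → sumFamilies m (λ F → χ (sameFamily F G) * h F) ≡ h G
sumFamilies-δ zero    false     h = trans (ℕ.+-identityʳ _) (ℕ.+-identityʳ _)
sumFamilies-δ zero    true      h = ℕ.+-identityʳ _
sumFamilies-δ (suc m) (G₀ , G₁) h = begin
  sumFamilies m (λ F₀ → sumFamilies m (λ F₁ → χ (sameFamily F₀ G₀ ∧ sameFamily F₁ G₁) * h (F₀ , F₁)))
    ≡⟨ sumFamilies-cong m (λ F₀ → trans (sumFamilies-cong m (λ F₁ → χ-∧-* (sameFamily F₀ G₀) _ _))
                                         (sumFamilies-* m (χ (sameFamily F₀ G₀)) _)) ⟩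
  sumFamilies m (λ F₀ → χ (sameFamily F₀ G₀) * sumFamilies m (λ F₁ → χ (sameFamily F₁ G₁) * h (F₀ , F₁)))
    ≡⟨ sumFamilies-cong m (λ F₀ → cong (χ (sameFamily F₀ G₀) *_) (sumFamilies-δ m G₁ _)) ⟩
  sumFamilies m (λ F₀ → χ (sameFamily F₀ G₀) * h (F₀ , G₁))
    ≡⟨ sumFamilies-δ m G₀ _ ⟩
  h (G₀ , G₁) ∎

sumSubsets-δ : ∀ m (B : Subset m) (h : Subset m → ℕ) → sumSubsets m (λ D → χ (sameSubset D B) * h D) ≡ h B
sumSubsets-δ zero    []          h = ℕ.+-identityʳ _
sumSubsets-δ (suc m) (false ∷ B) h =
  trans (cong₂ _+_ (sumSubsets-δ m B _) (sumSubsets-0 m)) (ℕ.+-identityʳ _)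
sumSubsets-δ (suc m) (true ∷ B)  h = cong₂ _+_ (sumSubsets-0 m) (sumSubsets-δ m B _)

sameFamily-singletonFamily : ∀ {m} (F : Family m) (B : Subset m) →
  sameFamily F (singletonFamily B) ≡ sameSubset B (theMember F) ∧ isSingletonFamily F
sameFamily-singletonFamily F B = T-injective ⇒ ⇐
  where
  ⇒ : T (sameFamily F (singletonFamily B)) → T (sameSubset B (theMember F) ∧ isSingletonFamily F)
  ⇒ same with refl ← sameFamily-sound {F = F} same
    rewrite theMember-singletonFamily B | sameSubset-refl B | sameFamily-refl (singletonFamily B) = _
  ⇐ : T (sameSubset B (theMember F) ∧ isSingletonFamily F) → T (sameFamily F (singletonFamily B))
  ⇐ both with Equivalence.to T-∧ both
  ... | B≡ , single with refl ← sameSubset-sound {B = B} B≡ = single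

sumFamilies-singletons : ∀ m (h : Family m → ℕ) →
  sumFamilies m (λ F → χ (isSingletonFamily F) * h F) ≡ sumSubsets m (λ B → h (singletonFamily B))
sumFamilies-singletons m h = begin
  sumFamilies m (λ F → χ (isSingletonFamily F) * h F)
    ≡⟨ sumFamilies-cong m (λ F → sym (sumSubsets-δ m (theMember F) (λ _ → χ (isSingletonFamily F) * h F))) ⟩
  sumFamilies m (λ F → sumSubsets m (λ B → χ (sameSubset B (theMember F)) * (χ (isSingletonFamily F) * h F)))
    ≡⟨ sumFamilies-cong m (λ F → sumSubsets-cong m (λ B → sym (trans (cong (λ b → χ b * h F)
         (sameFamily-singletonFamily F B)) (χ-∧-* (sameSubset B (theMember F)) _ _)))) ⟩
  sumFamilies m (λ F → sumSubsets m (λ B → χ (sameFamily F (singletonFamily B)) * h F))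
    ≡⟨ sumFamilies-sumSubsets m m _ ⟩
  sumSubsets m (λ B → sumFamilies m (λ F → χ (sameFamily F (singletonFamily B)) * h F))
    ≡⟨ sumSubsets-cong m (λ B → sumFamilies-δ m (singletonFamily B) h) ⟩
  sumSubsets m (λ B → h (singletonFamily B)) ∎

-- Partitions of a subset

infix 4 _∈ᶠ_

_∈ᶠ_ : ∀ {m} → Subset m → Family m → Set
B ∈ᶠ F = T (B ∈F F)

∉-emptyFamily : ∀ {m} (B : Subset m) → ¬ B ∈ᶠ emptyFamily
∉-emptyFamily B = subst T (∈-emptyFamily B)

∈-singletonFamily⁻ : ∀ {m} {D B : Subset m} → D ∈ᶠ singletonFamily B → D ≡ B
∈-singletonFamily⁻ {D = D} {B} = sameSubset-sound ∘ subst T (∈-singletonFamily D B)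

∈-singletonFamily⁺ : ∀ {m} (B : Subset m) → B ∈ᶠ singletonFamily B
∈-singletonFamily⁺ B = subst T (sym (trans (∈-singletonFamily B B) (sameSubset-refl B))) _

Disjoint : ∀ {m} → Subset m → Subset m → Set
Disjoint B D = ∀ {i} → i ∈ B → i ∉ D

record IsPartitionOf {m} (U : Subset m) (F : Family m) : Set where
  field
    nonempty : ∀ {B} → B ∈ᶠ F → Nonempty B
    within   : ∀ {B} → B ∈ᶠ F → B ⊆ U
    disjoint : ∀ {B D} → B ∈ᶠ F → D ∈ᶠ F → B ≡ D ⊎ Disjoint B D
    covering : ∀ {i} → i ∈ U → ∃[ B ] B ∈ᶠ F × i ∈ B

x∈p─q⇒x∉q : ∀ {m} {U B : Subset m} {i} → i ∈ U ─ B → i ∉ B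
x∈p─q⇒x∉q {U = _ ∷ _} {false ∷ _} (there i∈) (there i∈B) = x∈p─q⇒x∉q i∈ i∈B
x∈p─q⇒x∉q {U = _ ∷ _} {true ∷ _}  (there i∈) (there i∈B) = x∈p─q⇒x∉q i∈ i∈B

partition-[] : IsPartitionOf [] false
partition-[] = record
  { nonempty = λ { {[]} () }
  ; within   = λ { {[]} () }
  ; disjoint = λ { {[]} () }
  ; covering = λ { {()} }
  }

¬partition-[]-true : ¬ IsPartitionOf [] true
¬partition-[]-true P with IsPartitionOf.nonempty P {[]} _
... | () , _

module _ {m} {U : Subset (suc m)} {F₀ F₁ : Family m} (P : IsPartitionOf U (F₀ , F₁)) where
  open IsPartitionOf P

  nonempty-tail : ∀ {B} → B ∈ᶠ F₀ → Nonempty B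
  nonempty-tail {B} B∈F₀ with nonempty {false ∷ B} B∈F₀
  ... | Fin.suc i , there i∈B = i , i∈B

  disjoint-tail : ∀ {B D} → B ∈ᶠ F₀ → D ∈ᶠ F₀ → B ≡ D ⊎ Disjoint B D
  disjoint-tail {B} {D} B∈F₀ D∈F₀ with disjoint {false ∷ B} {false ∷ D} B∈F₀ D∈F₀
  ... | inj₁ eq       = inj₁ (∷-injectiveʳ eq)
  ... | inj₂ disjoint = inj₂ (λ i∈B i∈D → disjoint (there i∈B) (there i∈D))

partition-outside⁻ : ∀ {m} {U : Subset m} {F₀ F₁} →
  IsPartitionOf (false ∷ U) (F₀ , F₁) → F₁ ≡ emptyFamily × IsPartitionOf U F₀
partition-outside⁻ {m} {U} {F₀} {F₁} P = family-ext F₁≡∅ , record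
  { nonempty = nonempty-tail P ; within = within₀ ; disjoint = disjoint-tail P ; covering = covering₀ }
  where
  open IsPartitionOf P
  ∉F₁ : ∀ B → ¬ B ∈ᶠ F₁
  ∉F₁ B B∈F₁ with within {true ∷ B} B∈F₁ here
  ... | ()
  F₁≡∅ : ∀ B → B ∈F F₁ ≡ B ∈F emptyFamily
  F₁≡∅ B = T-injective (⊥-elim ∘ ∉F₁ B) (⊥-elim ∘ ∉-emptyFamily B)
  within₀ : ∀ {B} → B ∈ᶠ F₀ → B ⊆ U
  within₀ {B} B∈F₀ i∈B = drop-there (within {false ∷ B} B∈F₀ (there i∈B))
  covering₀ : ∀ {i} → i ∈ U → ∃[ B ] B ∈ᶠ F₀ × i ∈ B
  covering₀ i∈U with covering (there i∈U)
  ... | false ∷ B , B∈F₀ , there i∈B = B , B∈F₀ , i∈B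
  ... | true ∷ B  , B∈F₁ , _          = ⊥-elim (∉F₁ B B∈F₁)

partition-inside⁻ : ∀ {m} {U : Subset m} {F₀ F₁} → IsPartitionOf (true ∷ U) (F₀ , F₁) →
  ∃[ B₀ ] F₁ ≡ singletonFamily B₀ × B₀ ⊆ U × IsPartitionOf (U ─ B₀) F₀
partition-inside⁻ {m} {U} {F₀} {F₁} P with IsPartitionOf.covering P here
... | true ∷ B₀ , B₀∈F₁ , here = B₀ , family-ext F₁≡B₀ , B₀⊆U , record
  { nonempty = nonempty-tail P ; within = within₀ ; disjoint = disjoint-tail P ; covering = covering₀ }
  where
  open IsPartitionOf P
  unique : ∀ {D} → D ∈ᶠ F₁ → D ≡ B₀
  unique {D} D∈F₁ with disjoint {true ∷ D} {true ∷ B₀} D∈F₁ B₀∈F₁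
  ... | inj₁ eq       = ∷-injectiveʳ eq
  ... | inj₂ disjoint = ⊥-elim (disjoint here here)
  F₁≡B₀ : ∀ D → D ∈F F₁ ≡ D ∈F singletonFamily B₀
  F₁≡B₀ D = T-injective ⇒ ⇐
    where
    ⇒ : D ∈ᶠ F₁ → D ∈ᶠ singletonFamily B₀
    ⇒ D∈F₁ = subst (_∈ᶠ singletonFamily B₀) (sym (unique {D} D∈F₁)) (∈-singletonFamily⁺ B₀)
    ⇐ : D ∈ᶠ singletonFamily B₀ → D ∈ᶠ F₁
    ⇐ D∈B₀ = subst (_∈ᶠ F₁) (sym (∈-singletonFamily⁻ {D = D} D∈B₀)) B₀∈F₁
  B₀⊆U : B₀ ⊆ U
  B₀⊆U i∈B₀ = drop-there (within {true ∷ B₀} B₀∈F₁ (there i∈B₀))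
  avoids-B₀ : ∀ {B} → B ∈ᶠ F₀ → Disjoint B B₀
  avoids-B₀ {B} B∈F₀ with disjoint {false ∷ B} {true ∷ B₀} B∈F₀ B₀∈F₁
  ... | inj₂ disjoint = λ i∈B i∈B₀ → disjoint (there i∈B) (there i∈B₀)
  within₀ : ∀ {B} → B ∈ᶠ F₀ → B ⊆ U ─ B₀
  within₀ {B} B∈F₀ i∈B =
    x∈p∧x∉q⇒x∈p─q (drop-there (within {false ∷ B} B∈F₀ (there i∈B))) (avoids-B₀ B∈F₀ i∈B)
  covering₀ : ∀ {i} → i ∈ U ─ B₀ → ∃[ B ] B ∈ᶠ F₀ × i ∈ B
  covering₀ i∈U─B₀ with covering (there (p─q⊆p U B₀ i∈U─B₀))
  ... | false ∷ B , B∈F₀ , there i∈B = B , B∈F₀ , i∈B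
  ... | true ∷ B  , B∈F₁ , there i∈B =
    ⊥-elim (x∈p─q⇒x∉q i∈U─B₀ (subst (_ ∈_) (unique {B} B∈F₁) i∈B))

partition-outside⁺ : ∀ {m} {U : Subset m} {F₀} →
  IsPartitionOf U F₀ → IsPartitionOf (false ∷ U) (F₀ , emptyFamily)
partition-outside⁺ {m} {U} {F₀} P = record
  { nonempty = nonempty′ ; within = within′ ; disjoint = disjoint′ ; covering = covering′ }
  where
  open IsPartitionOf P
  nonempty′ : ∀ {B} → B ∈ᶠ (F₀ , emptyFamily) → Nonempty B
  nonempty′ {false ∷ B} B∈F₀ with nonempty B∈F₀
  ... | i , i∈B = Fin.suc i , there i∈B
  nonempty′ {true ∷ B} B∈∅ = ⊥-elim (∉-emptyFamily B B∈∅)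
  within′ : ∀ {B} → B ∈ᶠ (F₀ , emptyFamily) → B ⊆ false ∷ U
  within′ {false ∷ B} B∈F₀ (there i∈B) = there (within B∈F₀ i∈B)
  within′ {true ∷ B}  B∈∅              = ⊥-elim (∉-emptyFamily B B∈∅)
  disjoint′ : ∀ {B D} → B ∈ᶠ (F₀ , emptyFamily) → D ∈ᶠ (F₀ , emptyFamily) → B ≡ D ⊎ Disjoint B D
  disjoint′ {false ∷ B} {false ∷ D} B∈F₀ D∈F₀ with disjoint {B} {D} B∈F₀ D∈F₀
  ... | inj₁ refl     = inj₁ refl
  ... | inj₂ disjoint = inj₂ λ { (there i∈B) (there i∈D) → disjoint i∈B i∈D }
  disjoint′ {true ∷ B}            B∈∅ _   = ⊥-elim (∉-emptyFamily B B∈∅)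
  disjoint′ {false ∷ B} {true ∷ D} _  D∈∅ = ⊥-elim (∉-emptyFamily D D∈∅)
  covering′ : ∀ {i} → i ∈ false ∷ U → ∃[ B ] B ∈ᶠ (F₀ , emptyFamily) × i ∈ B
  covering′ (there i∈U) with covering i∈U
  ... | B , B∈F₀ , i∈B = false ∷ B , B∈F₀ , there i∈B

partition-inside⁺ : ∀ {m} {U : Subset m} {F₀} {B₀} →
  B₀ ⊆ U → IsPartitionOf (U ─ B₀) F₀ → IsPartitionOf (true ∷ U) (F₀ , singletonFamily B₀)
partition-inside⁺ {m} {U} {F₀} {B₀} B₀⊆U P = record
  { nonempty = nonempty′ ; within = within′ ; disjoint = disjoint′ ; covering = covering′ }
  where
  open IsPartitionOf P
  F = (F₀ , singletonFamily B₀)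
  avoids-B₀ : ∀ {B} → B ∈ᶠ F₀ → Disjoint B B₀
  avoids-B₀ B∈F₀ i∈B = x∈p─q⇒x∉q (within B∈F₀ i∈B)
  nonempty′ : ∀ {B} → B ∈ᶠ F → Nonempty B
  nonempty′ {false ∷ B} B∈F₀ with nonempty B∈F₀
  ... | i , i∈B = Fin.suc i , there i∈B
  nonempty′ {true ∷ B}  _    = Fin.zero , here
  within′ : ∀ {B} → B ∈ᶠ F → B ⊆ true ∷ U
  within′ {false ∷ B} B∈F₀ (there i∈B) = there (p─q⊆p U B₀ (within B∈F₀ i∈B))
  within′ {true ∷ B}  B∈B₀ here        = here
  within′ {true ∷ B}  B∈B₀ (there i∈B) =
    there (B₀⊆U (subst (_ ∈_) (∈-singletonFamily⁻ {D = B} B∈B₀) i∈B))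
  disjoint′ : ∀ {B D} → B ∈ᶠ F → D ∈ᶠ F → B ≡ D ⊎ Disjoint B D
  disjoint′ {false ∷ B} {false ∷ D} B∈F₀ D∈F₀ with disjoint {B} {D} B∈F₀ D∈F₀
  ... | inj₁ refl     = inj₁ refl
  ... | inj₂ disjoint = inj₂ λ { (there i∈B) (there i∈D) → disjoint i∈B i∈D }
  disjoint′ {false ∷ B} {true ∷ D}  B∈F₀ D∈B₀ with refl ← ∈-singletonFamily⁻ {D = D} D∈B₀ =
    inj₂ λ { (there i∈B) (there i∈D) → avoids-B₀ B∈F₀ i∈B i∈D }
  disjoint′ {true ∷ B}  {false ∷ D} B∈B₀ D∈F₀ with refl ← ∈-singletonFamily⁻ {D = B} B∈B₀ =
    inj₂ λ { (there i∈B) (there i∈D) → avoids-B₀ D∈F₀ i∈D i∈B }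
  disjoint′ {true ∷ B}  {true ∷ D}  B∈B₀ D∈B₀ =
    inj₁ (cong (true ∷_) (trans (∈-singletonFamily⁻ {D = B} B∈B₀) (sym (∈-singletonFamily⁻ {D = D} D∈B₀))))
  covering′ : ∀ {i} → i ∈ true ∷ U → ∃[ B ] B ∈ᶠ F × i ∈ B
  covering′ here = true ∷ B₀ , ∈-singletonFamily⁺ B₀ , here
  covering′ {Fin.suc i} (there i∈U) with i ∈? B₀
  ... | yes i∈B₀ = true ∷ B₀ , ∈-singletonFamily⁺ B₀ , there i∈B₀
  ... | no  i∉B₀ with covering (x∈p∧x∉q⇒x∈p─q i∈U i∉B₀)
  ...   | B , B∈F₀ , i∈B = false ∷ B , B∈F₀ , there i∈B

-- F partitions true ∷ U iff its only block through the first element is true ∷ B₀ with B₀ ⊆ U,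
-- and its other blocks partition U ─ B₀.
isPartitionOfᵇ : ∀ {m} → Subset m → Family m → Bool
isPartitionOfᵇ []          b         = not b
isPartitionOfᵇ (false ∷ U) (F₀ , F₁) = sameFamily F₁ emptyFamily ∧ isPartitionOfᵇ U F₀
isPartitionOfᵇ (true ∷ U)  (F₀ , F₁) =
  isSingletonFamily F₁ ∧ (does (theMember F₁ ⊆? U) ∧ isPartitionOfᵇ (U ─ theMember F₁) F₀)

isPartitionOfᵇ-sound : ∀ {m} (U : Subset m) F → T (isPartitionOfᵇ U F) → IsPartitionOf U F
isPartitionOfᵇ-sound []          false     _ = partition-[]
isPartitionOfᵇ-sound (false ∷ U) (F₀ , F₁) isP
  with F₁≡∅ , isP₀ ← Equivalence.to T-∧ isP
  with refl ← sameFamily-sound {F = F₁} F₁≡∅ = partition-outside⁺ (isPartitionOfᵇ-sound U F₀ isP₀)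
isPartitionOfᵇ-sound (true ∷ U)  (F₀ , F₁) isP
  with single , rest ← Equivalence.to T-∧ isP
  with B₀⊆U , isP₀ ← Equivalence.to T-∧ rest =
  subst (λ X → IsPartitionOf (true ∷ U) (F₀ , X)) (sym (sameFamily-sound {F = F₁} single))
        (partition-inside⁺ (T-does⁻ (theMember F₁ ⊆? U) B₀⊆U)
                           (isPartitionOfᵇ-sound (U ─ theMember F₁) F₀ isP₀))

isPartitionOfᵇ-complete : ∀ {m} (U : Subset m) F → IsPartitionOf U F → T (isPartitionOfᵇ U F)
isPartitionOfᵇ-complete []          false     _ = _
isPartitionOfᵇ-complete []          true      P = ¬partition-[]-true P
isPartitionOfᵇ-complete {suc m} (false ∷ U) (F₀ , F₁) P
  with refl , P₀ ← partition-outside⁻ P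
  rewrite sameFamily-refl (emptyFamily {m}) = isPartitionOfᵇ-complete U F₀ P₀
isPartitionOfᵇ-complete (true ∷ U)  (F₀ , F₁) P
  with B₀ , refl , B₀⊆U , P₀ ← partition-inside⁻ P
  rewrite theMember-singletonFamily B₀ | sameFamily-refl (singletonFamily B₀) =
  Equivalence.from T-∧ (T-does⁺ (B₀ ⊆? U) B₀⊆U , isPartitionOfᵇ-complete (U ─ B₀) F₀ P₀)

T-not-∧⁺ : ∀ {a b} → (T a → ¬ T b) → T (not (a ∧ b))
T-not-∧⁺ {false}         _       = _
T-not-∧⁺ {true}  {false} _       = _
T-not-∧⁺ {true}  {true}  a⇒¬b    = a⇒¬b _ _

T-not-∧⁻ : ∀ {a b} → T (not (a ∧ b)) → T a → ¬ T b
T-not-∧⁻ {true} {true} ()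

T-lookup⇒∈ : ∀ {m} {B : Subset m} {i} → T (lookup B i) → i ∈ B
T-lookup⇒∈ {B = B} {i} = lookup⇒[]= i B ∘ Equivalence.to T-≡

∈⇒T-lookup : ∀ {m} {B : Subset m} {i} → i ∈ B → T (lookup B i)
∈⇒T-lookup = Equivalence.from T-≡ ∘ []=⇒lookup

allSubsets-complete : ∀ m (B : Subset m) → B ∈ˡ allSubsets m
allSubsets-complete zero    []          = Any.here refl
allSubsets-complete (suc m) (false ∷ B) = ∈-++⁺ˡ (∈-map⁺ (false ∷_) (allSubsets-complete m B))
allSubsets-complete (suc m) (true ∷ B)  =
  ∈-++⁺ʳ (List.map (false ∷_) (allSubsets m)) (∈-map⁺ (true ∷_) (allSubsets-complete m B))

members⁻ : ∀ {m} {F : Family m} {B} → B ∈ˡ members F → B ∈ᶠ F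
members⁻ {m} {F} = proj₂ ∘ ∈-filter⁻ (T? ∘ (_∈F F)) {xs = allSubsets m}

members⁺ : ∀ {m} {F : Family m} {B} → B ∈ᶠ F → B ∈ˡ members F
members⁺ {m} {F} {B} = ∈-filter⁺ (T? ∘ (_∈F F)) (allSubsets-complete m B)

module _ {m} (F : Family m) where

  sameOrDisjointᵇ : Subset m → Subset m → Bool
  sameOrDisjointᵇ B D = eqSubsetᵇ B D ∨ disjointᵇ B D

  coveredᵇ : Fin m → Bool
  coveredᵇ i = any (λ B → lookup B i) (members F)

  blocksNonemptyᵇ blocksDisjointᵇ blocksCoverᵇ : Bool
  blocksNonemptyᵇ = all nonemptyᵇ (members F)
  blocksDisjointᵇ = all (λ B → all (sameOrDisjointᵇ B) (members F)) (members F)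
  blocksCoverᵇ    = all coveredᵇ (allFin m)

isPartition⇒IsPartitionOf⊤ : ∀ {m} {F : Family m} → T (isPartition F) → IsPartitionOf ⊤ F
isPartition⇒IsPartitionOf⊤ {m} {F} isP = record
  { nonempty = nonempty′ ; within = λ _ _ → ∈⊤ ; disjoint = disjoint′ ; covering = covering′ }
  where
  allNonempty : T (blocksNonemptyᵇ F)
  allNonempty = proj₁ (Equivalence.to (T-∧ {blocksNonemptyᵇ F}) isP)
  allDisjointAndCover : T (blocksDisjointᵇ F ∧ blocksCoverᵇ F)
  allDisjointAndCover = proj₂ (Equivalence.to (T-∧ {blocksNonemptyᵇ F}) isP)
  allDisjoint : T (blocksDisjointᵇ F)
  allDisjoint = proj₁ (Equivalence.to (T-∧ {blocksDisjointᵇ F}) allDisjointAndCover)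
  allCover : T (blocksCoverᵇ F)
  allCover = proj₂ (Equivalence.to (T-∧ {blocksDisjointᵇ F}) allDisjointAndCover)
  nonempty′ : ∀ {B} → B ∈ᶠ F → Nonempty B
  nonempty′ {B} B∈F
    with i , i∈B ← Any.satisfied (any⁻ (lookup B) (allFin m)
                     (All.lookup (all⁺ nonemptyᵇ (members F) allNonempty) (members⁺ {F = F} {B} B∈F)))
    = i , T-lookup⇒∈ i∈B
  disjoint′ : ∀ {B D} → B ∈ᶠ F → D ∈ᶠ F → B ≡ D ⊎ Disjoint B D
  disjoint′ {B} {D} B∈F D∈F
    with Equivalence.to T-∨ (All.lookup (all⁺ (sameOrDisjointᵇ F B) (members F)
           (All.lookup (all⁺ _ (members F) allDisjoint) (members⁺ {F = F} {B} B∈F))) (members⁺ {F = F} {D} D∈F))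
  ... | inj₁ same = inj₁ (T-does⁻ (≡-dec Bool._≟_ B D) same)
  ... | inj₂ apart = inj₂ λ {i} i∈B i∈D →
    T-not-∧⁻ (All.lookup (all⁺ (λ i → not (lookup B i ∧ lookup D i)) (allFin m) apart) (∈-allFin i))
             (∈⇒T-lookup i∈B) (∈⇒T-lookup i∈D)
  covering′ : ∀ {i} → i ∈ ⊤ → ∃[ B ] B ∈ᶠ F × i ∈ B
  covering′ {i} _
    with B , B∈ , i∈B ← find (any⁻ (λ B → lookup B i) (members F)
                          (All.lookup (all⁺ (coveredᵇ F) (allFin m) allCover) (∈-allFin i)))
    = B , members⁻ {F = F} B∈ , T-lookup⇒∈ i∈B

IsPartitionOf⊤⇒isPartition : ∀ {m} {F : Family m} → IsPartitionOf ⊤ F → T (isPartition F)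
IsPartitionOf⊤⇒isPartition {m} {F} P =
  Equivalence.from T-∧ (allNonempty , Equivalence.from T-∧ (allDisjoint , allCover))
  where
  open IsPartitionOf P
  allNonempty : T (blocksNonemptyᵇ F)
  allNonempty = all⁻ nonemptyᵇ (All.tabulate λ {B} B∈ →
    let i , i∈B = nonempty (members⁻ {F = F} {B} B∈)
    in any⁺ (lookup B) (lose (∈-allFin i) (∈⇒T-lookup {B = B} i∈B)))
  sameOrDisjoint : ∀ B D → B ≡ D ⊎ Disjoint B D → T (sameOrDisjointᵇ F B D)
  sameOrDisjoint B _ (inj₁ refl) = Equivalence.from T-∨ (inj₁ (T-does⁺ (≡-dec Bool._≟_ B B) refl))
  sameOrDisjoint B D (inj₂ apart) = Equivalence.from (T-∨ {eqSubsetᵇ B D}) (inj₂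
    (all⁻ (λ i → not (lookup B i ∧ lookup D i)) {allFin _} (All.tabulate λ {i} _ →
      T-not-∧⁺ {lookup B i} {lookup D i} (λ i∈B i∈D → apart (T-lookup⇒∈ i∈B) (T-lookup⇒∈ i∈D)))))
  allDisjoint : T (blocksDisjointᵇ F)
  allDisjoint = all⁻ _ (All.tabulate λ {B} B∈ → all⁻ (sameOrDisjointᵇ F B) (All.tabulate λ {D} D∈ →
    sameOrDisjoint B D (disjoint {B} {D} (members⁻ {F = F} {B} B∈) (members⁻ {F = F} {D} D∈))))
  allCover : T (blocksCoverᵇ F)
  allCover = all⁻ (coveredᵇ F) {allFin m} (All.tabulate λ {i} _ →
    let B , B∈F , i∈B = covering (∈⊤ {x = i})
    in any⁺ (λ B → lookup B i) (lose (members⁺ {F = F} {B} B∈F) (∈⇒T-lookup {B = B} i∈B)))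

isPartition≡isPartitionOfᵇ⊤ : ∀ {m} (F : Family m) → isPartition F ≡ isPartitionOfᵇ ⊤ F
isPartition≡isPartitionOfᵇ⊤ F = T-injective
  (isPartitionOfᵇ-complete ⊤ F ∘ isPartition⇒IsPartitionOf⊤)
  (IsPartitionOf⊤⇒isPartition ∘ isPartitionOfᵇ-sound ⊤ F)

-- Weighted counts of partitions, by the block of the first element

sumPartitions : ∀ {m} → Subset m → (Family m → ℕ) → ℕ
sumPartitions {zero}  []          w = w false
sumPartitions {suc m} (false ∷ U) w = sumPartitions U (λ F₀ → w (F₀ , emptyFamily))
sumPartitions {suc m} (true ∷ U)  w =
  sumSubsets m (λ B → χ (does (B ⊆? U)) * sumPartitions (U ─ B) (λ F₀ → w (F₀ , singletonFamily B)))

sumPartitions-cong : ∀ {m} (U : Subset m) {w w′ : Family m → ℕ} → (∀ F → w F ≡ w′ F) →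
                     sumPartitions U w ≡ sumPartitions U w′
sumPartitions-cong []          w≡w′ = w≡w′ false
sumPartitions-cong (false ∷ U) w≡w′ = sumPartitions-cong U (λ _ → w≡w′ _)
sumPartitions-cong {suc m} (true ∷ U) w≡w′ =
  sumSubsets-cong m (λ B → cong (χ (does (B ⊆? U)) *_) (sumPartitions-cong (U ─ B) (λ _ → w≡w′ _)))

sumPartitions-* : ∀ {m} (U : Subset m) c (w : Family m → ℕ) →
                  sumPartitions U (λ F → c * w F) ≡ c * sumPartitions U w
sumPartitions-* []          c w = refl
sumPartitions-* (false ∷ U) c w = sumPartitions-* U c _
sumPartitions-* {suc m} (true ∷ U) c w = begin
  sumSubsets m (λ B → χ (does (B ⊆? U)) * sumPartitions (U ─ B) (λ F₀ → c * w (F₀ , singletonFamily B)))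
    ≡⟨ sumSubsets-cong m (λ B → trans (cong (χ (does (B ⊆? U)) *_) (sumPartitions-* (U ─ B) c _))
                                      (*-leftComm (χ (does (B ⊆? U))) c _)) ⟩
  sumSubsets m (λ B → c * (χ (does (B ⊆? U)) * sumPartitions (U ─ B) (λ F₀ → w (F₀ , singletonFamily B))))
    ≡⟨ sumSubsets-* m c _ ⟩
  c * sumPartitions (true ∷ U) w ∎

sumFamilies-isPartitionOf : ∀ {m} (U : Subset m) (w : Family m → ℕ) →
  sumFamilies m (λ F → χ (isPartitionOfᵇ U F) * w F) ≡ sumPartitions U w
sumFamilies-isPartitionOf [] w = trans (ℕ.+-identityʳ _) (ℕ.+-identityʳ _)
sumFamilies-isPartitionOf {suc m} (false ∷ U) w = begin
  sumFamilies m (λ F₀ → sumFamilies m (λ F₁ →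
    χ (sameFamily F₁ emptyFamily ∧ isPartitionOfᵇ U F₀) * w (F₀ , F₁)))
    ≡⟨ sumFamilies-cong m (λ F₀ → trans (sumFamilies-cong m (λ F₁ → χ-∧-* (sameFamily F₁ emptyFamily) _ _))
                                         (sumFamilies-δ m emptyFamily _)) ⟩
  sumFamilies m (λ F₀ → χ (isPartitionOfᵇ U F₀) * w (F₀ , emptyFamily))
    ≡⟨ sumFamilies-isPartitionOf U _ ⟩
  sumPartitions U (λ F₀ → w (F₀ , emptyFamily)) ∎
sumFamilies-isPartitionOf {suc m} (true ∷ U) w = begin
  sumFamilies m (λ F₀ → sumFamilies m (λ F₁ → χ (single F₁ ∧ (within F₁ ∧ rest F₀ F₁)) * w (F₀ , F₁)))
    ≡⟨ sumFamilies-cong m (λ F₀ → sumFamilies-cong m (λ F₁ → split F₀ F₁)) ⟩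
  sumFamilies m (λ F₀ → sumFamilies m (λ F₁ →
    χ (single F₁) * (χ (within F₁) * (χ (rest F₀ F₁) * w (F₀ , F₁)))))
    ≡⟨ sumFamilies-swap m m _ ⟩
  sumFamilies m (λ F₁ → sumFamilies m (λ F₀ →
    χ (single F₁) * (χ (within F₁) * (χ (rest F₀ F₁) * w (F₀ , F₁)))))
    ≡⟨ sumFamilies-cong m (λ F₁ → trans (sumFamilies-* m (χ (single F₁)) _)
                                         (cong (χ (single F₁) *_) (sumFamilies-* m (χ (within F₁)) _))) ⟩
  sumFamilies m (λ F₁ → χ (single F₁) * inner F₁)
    ≡⟨ sumFamilies-singletons m inner ⟩
  sumSubsets m (λ B → inner (singletonFamily B))
    ≡⟨ sumSubsets-cong m (λ B → cong (λ B′ → χ (does (B′ ⊆? U)) *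
                                       sumFamilies m (λ F₀ → χ (isPartitionOfᵇ (U ─ B′) F₀) * w (F₀ , singletonFamily B)))
                                     (theMember-singletonFamily B)) ⟩
  sumSubsets m (λ B → χ (does (B ⊆? U)) *
    sumFamilies m (λ F₀ → χ (isPartitionOfᵇ (U ─ B) F₀) * w (F₀ , singletonFamily B)))
    ≡⟨ sumSubsets-cong m (λ B → cong (χ (does (B ⊆? U)) *_) (sumFamilies-isPartitionOf (U ─ B) _)) ⟩
  sumPartitions (true ∷ U) w ∎
  where
  single : Family m → Bool
  single = isSingletonFamily
  within : Family m → Bool
  within F₁ = does (theMember F₁ ⊆? U)
  rest : Family m → Family m → Bool
  rest F₀ F₁ = isPartitionOfᵇ (U ─ theMember F₁) F₀
  inner : Family m → ℕ
  inner F₁ = χ (within F₁) * sumFamilies m (λ F₀ → χ (rest F₀ F₁) * w (F₀ , F₁))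
  split : ∀ F₀ F₁ → χ (single F₁ ∧ (within F₁ ∧ rest F₀ F₁)) * w (F₀ , F₁)
                  ≡ χ (single F₁) * (χ (within F₁) * (χ (rest F₀ F₁) * w (F₀ , F₁)))
  split F₀ F₁ = trans (χ-∧-* (single F₁) _ _) (cong (χ (single F₁) *_) (χ-∧-* (within F₁) _ _))

countPartitions≡sumPartitions : ∀ m (P : Family m → Bool) → countPartitions m P ≡ sumPartitions ⊤ (χ ∘ P)
countPartitions≡sumPartitions m P = begin
  countPartitions m P
    ≡⟨ countPartitions≡sumFamilies m P ⟩
  sumFamilies m (λ F → χ (isPartition F ∧ P F))
    ≡⟨ sumFamilies-cong m (λ F → trans (cong (λ b → χ (b ∧ P F)) (isPartition≡isPartitionOfᵇ⊤ F))
                                       (χ-∧ (isPartitionOfᵇ ⊤ F) (P F))) ⟩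
  sumFamilies m (λ F → χ (isPartitionOfᵇ ⊤ F) * χ (P F))
    ≡⟨ sumFamilies-isPartitionOf ⊤ (χ ∘ P) ⟩
  sumPartitions ⊤ (χ ∘ P) ∎

module ℕΣ = BinomialSums ℕ.+-*-isCommutativeSemiring
open ℕΣ hiding (_×_; _^_)

sumSubsets-⊆ : ∀ {m} (U : Subset m) (g : ℕ → ℕ → ℕ) →
  sumSubsets m (λ B → χ (does (B ⊆? U)) * g ∣ B ∣ ∣ U ─ B ∣) ≡ subsetSum ∣ U ∣ g
sumSubsets-⊆ []                   g = ℕ.+-identityʳ _
sumSubsets-⊆ {suc m} (false ∷ U) g = trans (cong₂ _+_ (sumSubsets-⊆ U g) (sumSubsets-0 m)) (ℕ.+-identityʳ _)
sumSubsets-⊆ (true ∷ U)           g = cong₂ _+_ (sumSubsets-⊆ U _) (sumSubsets-⊆ U _)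

-- Weights that factor over the blocks, up to a parameter that each block moves to next p (for S, the
-- number of blocks still to come). For them the weighted count of the partitions of U depends only on ∣ U ∣.
module Multiplicative {P : Set} (next : P → P) (c : P → ℕ → ℕ) (w : P → ∀ {m} → Family m → ℕ)
  (w-outside : ∀ p {m} (F : Family m) → w p (F , emptyFamily) ≡ w p F)
  (w-block : ∀ p {m} (F : Family m) B → w p (F , singletonFamily B) ≡ c p ∣ B ∣ * w (next p) F)
  where

  total : P → ℕ → ℕ
  total p t = sumPartitions (⊤ {t}) (w p)

  private
    Invariant : ℕ → Set
    Invariant m = ∀ p (U : Subset m) → sumPartitions U (w p) ≡ total p ∣ U ∣

    sumPartitions-inside : ∀ {m} → Invariant m → ∀ p (U : Subset m) →
      sumPartitions (true ∷ U) (w p) ≡ subsetSum ∣ U ∣ (λ i j → c p i * total (next p) j)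
    sumPartitions-inside {m} inv p U = begin
      sumSubsets m (λ B → χ (does (B ⊆? U)) * sumPartitions (U ─ B) (λ F → w p (F , singletonFamily B)))
        ≡⟨ sumSubsets-cong m (λ B → cong (χ (does (B ⊆? U)) *_) (begin
             sumPartitions (U ─ B) (λ F → w p (F , singletonFamily B))
               ≡⟨ sumPartitions-cong (U ─ B) (λ F → w-block p F B) ⟩
             sumPartitions (U ─ B) (λ F → c p ∣ B ∣ * w (next p) F)
               ≡⟨ sumPartitions-* (U ─ B) (c p ∣ B ∣) (w (next p)) ⟩
             c p ∣ B ∣ * sumPartitions (U ─ B) (w (next p))
               ≡⟨ cong (c p ∣ B ∣ *_) (inv (next p) (U ─ B)) ⟩
             c p ∣ B ∣ * total (next p) ∣ U ─ B ∣ ∎)) ⟩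
      sumSubsets m (λ B → χ (does (B ⊆? U)) * (c p ∣ B ∣ * total (next p) ∣ U ─ B ∣))
        ≡⟨ sumSubsets-⊆ U _ ⟩
      subsetSum ∣ U ∣ (λ i j → c p i * total (next p) j) ∎

    total-suc′ : ∀ {t} → Invariant t → ∀ p → total p (suc t) ≡ subsetSum t (λ i j → c p i * total (next p) j)
    total-suc′ {t} inv p =
      trans (sumPartitions-inside inv p ⊤)
            (cong (λ s → subsetSum s (λ i j → c p i * total (next p) j)) (∣⊤∣≡n t))

  sumPartitions-multiplicative : ∀ m p (U : Subset m) → sumPartitions U (w p) ≡ total p ∣ U ∣
  sumPartitions-multiplicative = <-rec Invariant step
    where
    step : ∀ m → (∀ {t} → t < m → Invariant t) → Invariant m
    step zero    _  p []          = refl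
    step (suc m) ih p (false ∷ U) = trans (sumPartitions-cong U (w-outside p)) (ih ℕ.≤-refl p U)
    step (suc m) ih p (true ∷ U)  =
      trans (sumPartitions-inside (ih ℕ.≤-refl) p U) (sym (total-suc′ (ih (s≤s (∣p∣≤n U))) p))

  total-suc : ∀ p t → total p (suc t) ≡ subsetSum t (λ i j → c p i * total (next p) j)
  total-suc p t = total-suc′ (sumPartitions-multiplicative t) p

-- The numbers V, S and B

all-allFin-suc : ∀ n (p : Fin (suc n) → Bool) → all p (allFin (suc n)) ≡ p Fin.zero ∧ all (p ∘ Fin.suc) (allFin n)
all-allFin-suc n p =
  cong (λ xs → p Fin.zero ∧ and xs)
       (trans (List.map-tabulate Fin.suc p) (sym (List.map-tabulate (λ i → i) (p ∘ Fin.suc))))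

any-allFin-suc : ∀ n (p : Fin (suc n) → Bool) → any p (allFin (suc n)) ≡ p Fin.zero ∨ any (p ∘ Fin.suc) (allFin n)
any-allFin-suc n p =
  cong (λ xs → p Fin.zero ∨ or xs)
       (trans (List.map-tabulate Fin.suc p) (sym (List.map-tabulate (λ i → i) (p ∘ Fin.suc))))

positive : ℕ → ℕ
positive zero    = 0
positive (suc _) = 1

χ-positive-∧ : ∀ i b → χ (not (i ≡ᵇ 0) ∧ b) ≡ positive i * χ b
χ-positive-∧ zero    b = refl
χ-positive-∧ (suc i) b = sym (ℕ.*-identityˡ (χ b))

sameSubset-⊥ : ∀ {m} (B : Subset m) → sameSubset ⊥ B ≡ (∣ B ∣ ≡ᵇ 0)
sameSubset-⊥ []          = refl
sameSubset-⊥ (false ∷ B) = sameSubset-⊥ B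
sameSubset-⊥ (true ∷ B)  = refl

noSingletonsᵇ : ∀ {m} → Family m → Bool
noSingletonsᵇ F = all (λ i → not (singletonBlock F i)) (allFin _)

noSingletonsᵇ-pair : ∀ {m} (F₀ X : Family m) → noSingletonsᵇ (F₀ , X) ≡ not (⊥ ∈F X) ∧ noSingletonsᵇ F₀
noSingletonsᵇ-pair {m} F₀ X = all-allFin-suc m _

noSingletonsᵇ-outside : ∀ {m} (F : Family m) → noSingletonsᵇ (F , emptyFamily) ≡ noSingletonsᵇ F
noSingletonsᵇ-outside {m} F =
  trans (noSingletonsᵇ-pair F emptyFamily) (cong (λ b → not b ∧ noSingletonsᵇ F) (∈-emptyFamily (⊥ {m})))

χ-noSingletonsᵇ-block : ∀ {m} (F : Family m) B →
  χ (noSingletonsᵇ (F , singletonFamily B)) ≡ positive ∣ B ∣ * χ (noSingletonsᵇ F)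
χ-noSingletonsᵇ-block F B = begin
  χ (noSingletonsᵇ (F , singletonFamily B))
    ≡⟨ cong χ (noSingletonsᵇ-pair F (singletonFamily B)) ⟩
  χ (not (⊥ ∈F singletonFamily B) ∧ noSingletonsᵇ F)
    ≡⟨ cong (λ b → χ (not b ∧ noSingletonsᵇ F)) (trans (∈-singletonFamily ⊥ B) (sameSubset-⊥ B)) ⟩
  χ (not (∣ B ∣ ≡ᵇ 0) ∧ noSingletonsᵇ F)
    ≡⟨ χ-positive-∧ ∣ B ∣ (noSingletonsᵇ F) ⟩
  positive ∣ B ∣ * χ (noSingletonsᵇ F) ∎

module NoSingletons = Multiplicative {Unit} (λ p → p) (λ _ → positive) (λ _ → χ ∘ noSingletonsᵇ)
  (λ _ F → cong χ (noSingletonsᵇ-outside F)) (λ _ → χ-noSingletonsᵇ-block)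

V-suc : ∀ t → V (suc t) ≡ subsetSum t (λ i j → positive i * V j)
V-suc t = begin
  V (suc t)
    ≡⟨ countPartitions≡sumPartitions (suc t) noSingletonsᵇ ⟩
  NoSingletons.total tt (suc t)
    ≡⟨ NoSingletons.total-suc tt t ⟩
  subsetSum t (λ i j → positive i * NoSingletons.total tt j)
    ≡⟨ subsetSum-cong t (λ i j → cong (positive i *_) (sym (countPartitions≡sumPartitions j noSingletonsᵇ))) ⟩
  subsetSum t (λ i j → positive i * V j) ∎

numBlocks-pair : ∀ {m} (F₀ X : Family m) → numBlocks (F₀ , X) ≡ numBlocks F₀ + numBlocks X
numBlocks-pair F₀ X = trans (numBlocks≡sumSubsets (F₀ , X))
                            (sym (cong₂ _+_ (numBlocks≡sumSubsets F₀) (numBlocks≡sumSubsets X)))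

numBlocks-emptyFamily : ∀ m → numBlocks (emptyFamily {m}) ≡ 0
numBlocks-emptyFamily m = trans (numBlocks≡sumSubsets (emptyFamily {m}))
  (trans (sumSubsets-cong m (λ B → cong χ (∈-emptyFamily B))) (sumSubsets-0 m))

numBlocks-singletonFamily : ∀ {m} (B : Subset m) → numBlocks (singletonFamily B) ≡ 1
numBlocks-singletonFamily {m} B = trans (numBlocks≡sumSubsets (singletonFamily B))
  (trans (sumSubsets-cong m (λ D → trans (cong χ (∈-singletonFamily D B)) (sym (ℕ.*-identityʳ _))))
         (sumSubsets-δ m B (λ _ → 1)))

χ-numBlocks-outside : ∀ j {m} (F : Family m) → χ (numBlocks (F , emptyFamily) ≡ᵇ j) ≡ χ (numBlocks F ≡ᵇ j)
χ-numBlocks-outside j {m} F =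
  cong (λ x → χ (x ≡ᵇ j)) (trans (numBlocks-pair F emptyFamily)
                                 (trans (cong (numBlocks F +_) (numBlocks-emptyFamily m)) (ℕ.+-identityʳ _)))

χ-numBlocks-block : ∀ j {m} (F : Family m) B →
  χ (numBlocks (F , singletonFamily B) ≡ᵇ j) ≡ positive j * χ (numBlocks F ≡ᵇ pred j)
χ-numBlocks-block j F B with numBlocks-suc ← trans (numBlocks-pair F (singletonFamily B))
    (trans (cong (numBlocks F +_) (numBlocks-singletonFamily B)) (ℕ.+-comm (numBlocks F) 1))
  rewrite numBlocks-suc with j
... | zero  = refl
... | suc j = sym (ℕ.*-identityˡ _)

module BlockCount = Multiplicative pred (λ j _ → positive j) (λ j F → χ (numBlocks F ≡ᵇ j))
  χ-numBlocks-outside χ-numBlocks-block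

S-suc : ∀ t j → S (suc t) j ≡ subsetSum t (λ _ a → positive j * S a (pred j))
S-suc t j = begin
  S (suc t) j
    ≡⟨ countPartitions≡sumPartitions (suc t) _ ⟩
  BlockCount.total j (suc t)
    ≡⟨ BlockCount.total-suc j t ⟩
  subsetSum t (λ _ a → positive j * BlockCount.total (pred j) a)
    ≡⟨ subsetSum-cong t (λ _ a → cong (positive j *_) (sym (countPartitions≡sumPartitions a _))) ⟩
  subsetSum t (λ _ a → positive j * S a (pred j)) ∎

S-suc-zero : ∀ t → S (suc t) 0 ≡ 0
S-suc-zero t = trans (S-suc t 0) (subsetSum-0 t)

S-suc-suc : ∀ t j → S (suc t) (suc j) ≡ subsetSum t (λ _ a → S a j)
S-suc-suc t j = trans (S-suc t (suc j)) (subsetSum-cong t (λ _ a → ℕ.*-identityˡ (S a j)))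

S-vanishes : ∀ a j → a < j → S a j ≡ 0
S-vanishes = <-rec (λ a → ∀ j → a < j → S a j ≡ 0) step
  where
  step : ∀ a → (∀ {b} → b < a → ∀ j → b < j → S b j ≡ 0) → ∀ j → a < j → S a j ≡ 0
  step zero    _  (suc j) _         = refl
  step (suc a) ih (suc j) (s≤s a<j) = begin
    S (suc a) (suc j)
      ≡⟨ S-suc-suc a j ⟩
    subsetSum a (λ _ b → S b j)
      ≡⟨ subsetSum-cong-on a (λ i b i+b≡a → let b≤a = ℕ.≤-trans (ℕ.m≤n+m b i) (ℕ.≤-reflexive i+b≡a)
                                             in ih (s≤s b≤a) j (ℕ.≤-trans (s≤s b≤a) a<j)) ⟩
    subsetSum a (λ _ _ → 0)
      ≡⟨ subsetSum-0 a ⟩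
    0 ∎

module AllPartitions = Multiplicative {Unit} (λ p → p) (λ _ _ → 1) (λ _ _ → 1) (λ _ _ → refl) (λ _ _ _ → refl)

Bell-suc : ∀ t → Bell (suc t) ≡ subsetSum t (λ _ j → Bell j)
Bell-suc t = begin
  Bell (suc t)
    ≡⟨ countPartitions≡sumPartitions (suc t) _ ⟩
  AllPartitions.total tt (suc t)
    ≡⟨ AllPartitions.total-suc tt t ⟩
  subsetSum t (λ _ j → 1 * AllPartitions.total tt j)
    ≡⟨ subsetSum-cong t (λ _ j → trans (ℕ.*-identityˡ _) (sym (countPartitions≡sumPartitions j _))) ⟩
  subsetSum t (λ _ j → Bell j) ∎

-- V r + V (r + 1) is a sum over the subsets of {1, …, r}: the empty one gives V r, the others give V (r + 1).
V+V-suc : ∀ r → subsetSum r (λ _ b → V b) ≡ V r + V (suc r)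
V+V-suc r = begin
  subsetSum r (λ _ b → V b)
    ≡⟨ subsetSum-cong r split ⟩
  subsetSum r (λ a b → onlyZero a b + positive a * V b)
    ≡⟨ subsetSum-+ r onlyZero _ ⟩
  subsetSum r onlyZero + subsetSum r (λ a b → positive a * V b)
    ≡⟨ cong₂ _+_ (subsetSum-onlyEmpty r onlyZero (λ _ _ → refl)) (sym (V-suc r)) ⟩
  V r + V (suc r) ∎
  where
  onlyZero : ℕ → ℕ → ℕ
  onlyZero zero    b = V b
  onlyZero (suc _) _ = 0
  split : ∀ a b → V b ≡ onlyZero a b + positive a * V b
  split zero    b = sym (ℕ.+-identityʳ (V b))
  split (suc a) b = sym (ℕ.+-identityʳ (V b))

Bell≡subsetSum-V : ∀ n → Bell n ≡ subsetSum n (λ r _ → V r)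
Bell≡subsetSum-V = <-rec _ step
  where
  step : ∀ n → (∀ {m} → m < n → Bell m ≡ subsetSum m (λ r _ → V r)) → Bell n ≡ subsetSum n (λ r _ → V r)
  step zero    _  = refl
  step (suc t) ih = begin
    Bell (suc t)
      ≡⟨ Bell-suc t ⟩
    subsetSum t (λ _ j → Bell j)
      ≡⟨ subsetSum-cong-on t (λ i j i+j≡t →
           ih (s≤s (ℕ.≤-trans (ℕ.m≤n+m j i) (ℕ.≤-reflexive i+j≡t)))) ⟩
    subsetSum t (λ _ j → subsetSum j (λ r _ → V r))
      ≡⟨ subsetSum-assoc t (λ _ b _ → V b) ⟨
    subsetSum t (λ r _ → subsetSum r (λ _ b → V b))
      ≡⟨ subsetSum-cong t (λ r _ → V+V-suc r) ⟩
    subsetSum t (λ r _ → V r + V (suc r))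
      ≡⟨ subsetSum-+ t _ _ ⟩
    subsetSum (suc t) (λ r _ → V r) ∎

-- Partitions with largest singleton k + 1

^-ℕΣ : ∀ x n → x ℕΣ.^ n ≡ x ^ n
^-ℕΣ x zero    = refl
^-ℕΣ x (suc n) = cong (x *_) (^-ℕΣ x n)

suc-^ : ∀ j s → suc j ^ s ≡ subsetSum s (λ _ b → j ^ b)
suc-^ j s = sym (begin
  subsetSum s (λ _ b → j ^ b)
    ≡⟨ subsetSum-cong s (λ _ b → sym (^-ℕΣ j b)) ⟩
  subsetSum s (λ _ b → j ℕΣ.^ b)
    ≡⟨ subsetSum-^ s j ⟩
  (j + 1) ℕΣ.^ s
    ≡⟨ trans (^-ℕΣ (j + 1) s) (cong (_^ s) (ℕ.+-comm j 1)) ⟩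
  suc j ^ s ∎)

stirlingPowerSum : ℕ → ℕ → ℕ
stirlingPowerSum k s = sumUpTo k (λ j → S k j * j ^ s)

stirlingPowerSum-suc : ∀ k s →
  stirlingPowerSum (suc k) s ≡ subsetSum k (λ _ a → subsetSum s (λ _ b → stirlingPowerSum a b))
stirlingPowerSum-suc k s = begin
  sumUpTo (suc k) (λ j → S (suc k) j * j ^ s)
    ≡⟨ sumUpTo-suc k _ ⟩
  S (suc k) 0 * 0 ^ s + sumUpTo k (λ j → S (suc k) (suc j) * suc j ^ s)
    ≡⟨ cong₂ _+_ (cong (_* 0 ^ s) (S-suc-zero k)) (sumUpTo-cong k expand) ⟩
  sumUpTo k (λ j → subsetSum k (λ _ a → subsetSum s (λ _ b → S a j * j ^ b)))
    ≡⟨ subsetSum-sumUpTo k k _ ⟨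
  subsetSum k (λ _ a → sumUpTo k (λ j → subsetSum s (λ _ b → S a j * j ^ b)))
    ≡⟨ subsetSum-cong-on k (λ i a i+a≡k → trans (sym (subsetSum-sumUpTo s k _))
                                               (subsetSum-cong s (λ _ b → truncate i a i+a≡k b))) ⟩
  subsetSum k (λ _ a → subsetSum s (λ _ b → stirlingPowerSum a b)) ∎
  where
  expand : ∀ j → S (suc k) (suc j) * suc j ^ s ≡ subsetSum k (λ _ a → subsetSum s (λ _ b → S a j * j ^ b))
  expand j = begin
    S (suc k) (suc j) * suc j ^ s
      ≡⟨ cong₂ _*_ (S-suc-suc k j) (suc-^ j s) ⟩
    subsetSum k (λ _ a → S a j) * subsetSum s (λ _ b → j ^ b)
      ≡⟨ subsetSum-*ʳ k _ _ ⟩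
    subsetSum k (λ _ a → S a j * subsetSum s (λ _ b → j ^ b))
      ≡⟨ subsetSum-cong k (λ _ a → subsetSum-* s (S a j) _) ⟨
    subsetSum k (λ _ a → subsetSum s (λ _ b → S a j * j ^ b)) ∎
  truncate : ∀ i a → i + a ≡ k → ∀ b → sumUpTo k (λ j → S a j * j ^ b) ≡ stirlingPowerSum a b
  truncate i a i+a≡k b rewrite sym i+a≡k =
    sumUpTo-vanishing i a _ (λ j a<j → cong (_* j ^ b) (S-vanishes a j a<j))

-- A′ k n is the right-hand side of the first formula, before expanding the binomial sum.
A′ : ℕ → ℕ → ℕ
A′ k n = subsetSum n (λ r s → V r * stirlingPowerSum k s)

A′-zero : ∀ n → A′ 0 n ≡ V n
A′-zero n = begin
  subsetSum n (λ r s → V r * stirlingPowerSum 0 s)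
    ≡⟨ subsetSum-flip n (λ r s → V r * stirlingPowerSum 0 s) ⟨
  subsetSum n (λ s r → V r * stirlingPowerSum 0 s)
    ≡⟨ subsetSum-onlyEmpty n _ (λ s r → ℕ.*-zeroʳ (V r)) ⟩
  V n * 1
    ≡⟨ ℕ.*-identityʳ (V n) ⟩
  V n ∎

A′-suc : ∀ k n → A′ (suc k) n ≡ subsetSum k (λ _ a → subsetSum n (λ _ b → A′ a b))
A′-suc k n = begin
  subsetSum n (λ r s → V r * stirlingPowerSum (suc k) s)
    ≡⟨ subsetSum-cong n (λ r s → trans (cong (V r *_) (stirlingPowerSum-suc k s)) (sym (subsetSum-* k (V r) _))) ⟩
  subsetSum n (λ r s → subsetSum k (λ _ a → V r * subsetSum s (λ _ b → stirlingPowerSum a b)))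
    ≡⟨ subsetSum-subsetSum n k _ ⟩
  subsetSum k (λ _ a → subsetSum n (λ r s → V r * subsetSum s (λ _ b → stirlingPowerSum a b)))
    ≡⟨ subsetSum-cong k (λ _ a → regroup a) ⟩
  subsetSum k (λ _ a → subsetSum n (λ _ b → A′ a b)) ∎
  where
  -- Splitting n into (r, (l, b)) and into (l, (r, b)) give the same sum.
  regroup : ∀ a → subsetSum n (λ r s → V r * subsetSum s (λ _ b → stirlingPowerSum a b))
                ≡ subsetSum n (λ _ b → A′ a b)
  regroup a = begin
    subsetSum n (λ r s → V r * subsetSum s (λ _ b → stirlingPowerSum a b))
      ≡⟨ subsetSum-cong n (λ r s → sym (subsetSum-* s (V r) _)) ⟩
    subsetSum n (λ r s → subsetSum s (λ _ b → V r * stirlingPowerSum a b))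
      ≡⟨ subsetSum-assoc n (λ r _ b → V r * stirlingPowerSum a b) ⟨
    subsetSum n (λ x b → subsetSum x (λ r _ → V r * stirlingPowerSum a b))
      ≡⟨ subsetSum-cong n (λ x b → sym (subsetSum-flip x (λ r _ → V r * stirlingPowerSum a b))) ⟩
    subsetSum n (λ x b → subsetSum x (λ _ r → V r * stirlingPowerSum a b))
      ≡⟨ subsetSum-assoc n (λ _ r b → V r * stirlingPowerSum a b) ⟩
    subsetSum n (λ _ b → A′ a b) ∎

memberAt : ∀ {m} → ℕ → Subset m → Bool
memberAt k       []      = false
memberAt zero    (u ∷ U) = u
memberAt (suc k) (u ∷ U) = memberAt k U

countBelow : ∀ {m} → ℕ → Subset m → ℕ
countBelow k       []      = 0
countBelow zero    (u ∷ U) = 0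
countBelow (suc k) (u ∷ U) = χ u + countBelow k U

countAbove : ∀ {m} → ℕ → Subset m → ℕ
countAbove k       []      = 0
countAbove zero    (u ∷ U) = ∣ U ∣
countAbove (suc k) (u ∷ U) = countAbove k U

-- Position k has to stay in U ─ B, so B avoids it and is split into the parts of U below and above k.
sumSubsets-⊆-around : ∀ {m} k (U : Subset m) (g : ℕ → ℕ → ℕ) →
  sumSubsets m (λ B → χ (does (B ⊆? U)) *
    (χ (memberAt k (U ─ B)) * g (countBelow k (U ─ B)) (countAbove k (U ─ B))))
  ≡ χ (memberAt k U) * subsetSum (countBelow k U) (λ _ a → subsetSum (countAbove k U) (λ _ b → g a b))
sumSubsets-⊆-around k [] g = refl
sumSubsets-⊆-around {suc m} zero (true ∷ U) g = begin
  sumSubsets m (λ B → χ (does (B ⊆? U)) * (1 * g 0 (∣ U ─ B ∣)))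
    + sumSubsets m (λ B → χ (does (B ⊆? U)) * 0)
    ≡⟨ cong₂ _+_ (sumSubsets-cong m (λ B → cong (χ (does (B ⊆? U)) *_) (ℕ.*-identityˡ _)))
                 (trans (sumSubsets-cong m (λ B → ℕ.*-zeroʳ (χ (does (B ⊆? U))))) (sumSubsets-0 m)) ⟩
  sumSubsets m (λ B → χ (does (B ⊆? U)) * g 0 (∣ U ─ B ∣)) + 0
    ≡⟨ trans (ℕ.+-identityʳ _) (sumSubsets-⊆ U (λ _ j → g 0 j)) ⟩
  subsetSum (∣ U ∣) (λ _ b → g 0 b)
    ≡⟨ ℕ.*-identityˡ _ ⟨
  1 * subsetSum (∣ U ∣) (λ _ b → g 0 b) ∎
sumSubsets-⊆-around {suc m} zero (false ∷ U) g =
  cong₂ _+_ (trans (sumSubsets-cong m (λ B → ℕ.*-zeroʳ (χ (does (B ⊆? U))))) (sumSubsets-0 m)) (sumSubsets-0 m)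
sumSubsets-⊆-around (suc k) (true ∷ U) g =
  trans (cong₂ _+_ (sumSubsets-⊆-around k U (λ a b → g (suc a) b)) (sumSubsets-⊆-around k U g))
        (sym (ℕ.*-distribˡ-+ (χ (memberAt k U)) _ _))
sumSubsets-⊆-around {suc m} (suc k) (false ∷ U) g =
  trans (cong₂ _+_ (sumSubsets-⊆-around k U g) (sumSubsets-0 m)) (ℕ.+-identityʳ _)

singletonAt : ∀ {m} → ℕ → Family m → Fin m → Bool
singletonAt k F i = (toℕ i ≡ᵇ k) ∧ singletonBlock F i

singletonAbove : ∀ {m} → ℕ → Family m → Fin m → Bool
singletonAbove k F i = (k <ᵇ toℕ i) ∧ singletonBlock F i

largestSingletonᵇ : ∀ {m} → ℕ → Family m → Bool
largestSingletonᵇ k F = any (singletonAt k F) (allFin _) ∧ all (not ∘ singletonAbove k F) (allFin _)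

largestSingletonᵇ-suc : ∀ {m} k (F₀ X : Family m) →
  largestSingletonᵇ (suc k) (F₀ , X) ≡ largestSingletonᵇ k F₀
largestSingletonᵇ-suc {m} k F₀ X = cong₂ _∧_ (any-allFin-suc m (singletonAt (suc k) (F₀ , X)))
                                              (all-allFin-suc m (not ∘ singletonAbove (suc k) (F₀ , X)))

any-false : ∀ {a} {A : Set a} (xs : List A) → any (λ _ → false) xs ≡ false
any-false []       = refl
any-false (_ ∷ xs) = any-false xs

largestSingletonᵇ-zero : ∀ {m} (F₀ X : Family m) →
  largestSingletonᵇ 0 (F₀ , X) ≡ (⊥ ∈F X) ∧ noSingletonsᵇ F₀
largestSingletonᵇ-zero {m} F₀ X = cong₂ _∧_
  (trans (any-allFin-suc m (singletonAt 0 (F₀ , X)))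
         (trans (cong (⊥ ∈F X ∨_) (any-false (allFin m))) (∨-identityʳ _)))
  (all-allFin-suc m (not ∘ singletonAbove 0 (F₀ , X)))

V≡sumPartitions : ∀ {m} (U : Subset m) → sumPartitions U (χ ∘ noSingletonsᵇ) ≡ V ∣ U ∣
V≡sumPartitions {m} U =
  trans (NoSingletons.sumPartitions-multiplicative m tt U) (sym (countPartitions≡sumPartitions ∣ U ∣ _))

sumPartitions-largestSingleton : ∀ {m} k (U : Subset m) →
  sumPartitions U (χ ∘ largestSingletonᵇ k) ≡ χ (memberAt k U) * A′ (countBelow k U) (countAbove k U)
sumPartitions-largestSingleton k [] = refl
sumPartitions-largestSingleton {suc m} zero (false ∷ U) = begin
  sumPartitions U (λ F₀ → χ (largestSingletonᵇ 0 (F₀ , emptyFamily)))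
    ≡⟨ sumPartitions-cong U (λ F₀ → cong χ (trans (largestSingletonᵇ-zero F₀ emptyFamily)
                                                    (cong (_∧ noSingletonsᵇ F₀) (∈-emptyFamily (⊥ {m}))))) ⟩
  sumPartitions U (λ _ → 0 * 0)
    ≡⟨ sumPartitions-* U 0 (λ _ → 0) ⟩
  0 ∎
sumPartitions-largestSingleton {suc m} zero (true ∷ U) = begin
  sumSubsets m (λ B → χ (does (B ⊆? U)) *
    sumPartitions (U ─ B) (λ F₀ → χ (largestSingletonᵇ 0 (F₀ , singletonFamily B))))
    ≡⟨ sumSubsets-cong m (λ B → cong (χ (does (B ⊆? U)) *_) (inner B)) ⟩
  sumSubsets m (λ B → χ (does (B ⊆? U)) * (χ (∣ B ∣ ≡ᵇ 0) * V ∣ U ─ B ∣))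
    ≡⟨ sumSubsets-⊆ U (λ i j → χ (i ≡ᵇ 0) * V j) ⟩
  subsetSum (∣ U ∣) (λ i j → χ (i ≡ᵇ 0) * V j)
    ≡⟨ subsetSum-onlyEmpty (∣ U ∣) _ (λ _ _ → refl) ⟩
  1 * V (∣ U ∣)
    ≡⟨ cong (1 *_) (A′-zero ∣ U ∣) ⟨
  1 * A′ 0 (∣ U ∣) ∎
  where
  inner : ∀ B → sumPartitions (U ─ B) (λ F₀ → χ (largestSingletonᵇ 0 (F₀ , singletonFamily B)))
              ≡ χ (∣ B ∣ ≡ᵇ 0) * V (∣ U ─ B ∣)
  inner B = begin
    sumPartitions (U ─ B) (λ F₀ → χ (largestSingletonᵇ 0 (F₀ , singletonFamily B)))
      ≡⟨ sumPartitions-cong (U ─ B) (λ F₀ → trans (cong χ (largestSingletonᵇ-zero F₀ (singletonFamily B)))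
           (trans (cong (λ b → χ (b ∧ noSingletonsᵇ F₀)) (trans (∈-singletonFamily ⊥ B) (sameSubset-⊥ B)))
                  (χ-∧ (∣ B ∣ ≡ᵇ 0) (noSingletonsᵇ F₀)))) ⟩
    sumPartitions (U ─ B) (λ F₀ → χ (∣ B ∣ ≡ᵇ 0) * χ (noSingletonsᵇ F₀))
      ≡⟨ sumPartitions-* (U ─ B) (χ (∣ B ∣ ≡ᵇ 0)) _ ⟩
    χ (∣ B ∣ ≡ᵇ 0) * sumPartitions (U ─ B) (χ ∘ noSingletonsᵇ)
      ≡⟨ cong (χ (∣ B ∣ ≡ᵇ 0) *_) (V≡sumPartitions (U ─ B)) ⟩
    χ (∣ B ∣ ≡ᵇ 0) * V (∣ U ─ B ∣) ∎
sumPartitions-largestSingleton (suc k) (false ∷ U) =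
  trans (sumPartitions-cong U (λ F₀ → cong χ (largestSingletonᵇ-suc k F₀ emptyFamily)))
        (sumPartitions-largestSingleton k U)
sumPartitions-largestSingleton {suc m} (suc k) (true ∷ U) = begin
  sumSubsets m (λ B → χ (does (B ⊆? U)) *
    sumPartitions (U ─ B) (λ F₀ → χ (largestSingletonᵇ (suc k) (F₀ , singletonFamily B))))
    ≡⟨ sumSubsets-cong m (λ B → cong (χ (does (B ⊆? U)) *_)
         (trans (sumPartitions-cong (U ─ B) (λ F₀ → cong χ (largestSingletonᵇ-suc k F₀ (singletonFamily B))))
                (sumPartitions-largestSingleton k (U ─ B)))) ⟩
  sumSubsets m (λ B → χ (does (B ⊆? U)) *
    (χ (memberAt k (U ─ B)) * A′ (countBelow k (U ─ B)) (countAbove k (U ─ B))))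
    ≡⟨ sumSubsets-⊆-around k U A′ ⟩
  χ (memberAt k U) * subsetSum (countBelow k U) (λ _ a → subsetSum (countAbove k U) (λ _ b → A′ a b))
    ≡⟨ cong (χ (memberAt k U) *_) (A′-suc (countBelow k U) (countAbove k U)) ⟨
  χ (memberAt k U) * A′ (suc (countBelow k U)) (countAbove k U) ∎

memberAt-⊤ : ∀ k D → k < D → memberAt k (⊤ {D}) ≡ true
memberAt-⊤ zero    (suc D) _         = refl
memberAt-⊤ (suc k) (suc D) (s≤s k<D) = memberAt-⊤ k D k<D

countBelow-⊤ : ∀ k D → k < D → countBelow k (⊤ {D}) ≡ k
countBelow-⊤ zero    (suc D) _         = refl
countBelow-⊤ (suc k) (suc D) (s≤s k<D) = cong suc (countBelow-⊤ k D k<D)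

countAbove-⊤ : ∀ k D → k < D → countAbove k (⊤ {D}) ≡ D ∸ suc k
countAbove-⊤ zero    (suc D) _         = ∣⊤∣≡n D
countAbove-⊤ (suc k) (suc D) (s≤s k<D) = countAbove-⊤ k D k<D

A≡A′ : ∀ n k → A (n + k) k ≡ A′ k n
A≡A′ n k = begin
  A (n + k) k
    ≡⟨ countPartitions≡sumPartitions (suc (n + k)) (largestSingletonᵇ k) ⟩
  sumPartitions U (χ ∘ largestSingletonᵇ k)
    ≡⟨ sumPartitions-largestSingleton k U ⟩
  χ (memberAt k U) * A′ (countBelow k U) (countAbove k U)
    ≡⟨ cong₂ (λ b x → χ b * A′ x (countAbove k U)) (memberAt-⊤ k _ k<) (countBelow-⊤ k _ k<) ⟩
  1 * A′ k (countAbove k U)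
    ≡⟨ ℕ.*-identityˡ _ ⟩
  A′ k (countAbove k U)
    ≡⟨ cong (A′ k) (trans (countAbove-⊤ k _ k<) (ℕ.m+n∸n≡m n k)) ⟩
  A′ k n ∎
  where
  U = ⊤ {suc (n + k)}
  k< : k < suc (n + k)
  k< = s≤s (ℕ.m≤n+m k n)

×-ℕΣ : ∀ n x → n ℕΣ.× x ≡ n * x
×-ℕΣ zero    x = refl
×-ℕΣ (suc n) x = cong (x +_) (×-ℕΣ n x)

sumUpTo≡sumTo : ∀ n f → sumUpTo n f ≡ sumTo n f
sumUpTo≡sumTo zero    f = refl
sumUpTo≡sumTo (suc n) f = cong (_+ f (suc n)) (sumUpTo≡sumTo n f)

A≡binomialSum-V : ∀ n k → A (n + k) k ≡ sumTo n (λ r → sumTo k (λ j → (n C r) * V r * S k j * j ^ (n ∸ r)))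
A≡binomialSum-V n k = begin
  A (n + k) k
    ≡⟨ A≡A′ n k ⟩
  subsetSum n (λ r s → V r * stirlingPowerSum k s)
    ≡⟨ subsetSum≡binomialSum n _ ⟩
  sumUpTo n (λ r → (n C r) ℕΣ.× (V r * stirlingPowerSum k (n ∸ r)))
    ≡⟨ sumUpTo≡sumTo n _ ⟩
  sumTo n (λ r → (n C r) ℕΣ.× (V r * stirlingPowerSum k (n ∸ r)))
    ≡⟨ sumTo-cong n term ⟩
  sumTo n (λ r → sumTo k (λ j → (n C r) * V r * S k j * j ^ (n ∸ r))) ∎
  where
  sumTo-cong : ∀ n {f g : ℕ → ℕ} → (∀ r → f r ≡ g r) → sumTo n f ≡ sumTo n g
  sumTo-cong zero    f≡g = f≡g 0
  sumTo-cong (suc n) f≡g = cong₂ _+_ (sumTo-cong n f≡g) (f≡g (suc n))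
  term : ∀ r → (n C r) ℕΣ.× (V r * stirlingPowerSum k (n ∸ r))
             ≡ sumTo k (λ j → (n C r) * V r * S k j * j ^ (n ∸ r))
  term r = begin
    (n C r) ℕΣ.× (V r * stirlingPowerSum k (n ∸ r))
      ≡⟨ trans (×-ℕΣ (n C r) _) (sym (ℕ.*-assoc (n C r) (V r) _)) ⟩
    (n C r) * V r * sumUpTo k (λ j → S k j * j ^ (n ∸ r))
      ≡⟨ sumUpTo-* k ((n C r) * V r) _ ⟨
    sumUpTo k (λ j → (n C r) * V r * (S k j * j ^ (n ∸ r)))
      ≡⟨ trans (sumUpTo-cong k (λ j → sym (ℕ.*-assoc ((n C r) * V r) (S k j) _))) (sumUpTo≡sumTo k _) ⟩
    sumTo k (λ j → (n C r) * V r * S k j * j ^ (n ∸ r)) ∎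

open import Data.Integer using (ℤ; +_; _-_)
import Data.Integer as ℤ
import Data.Integer.Properties as ℤ

module ℤΣ = BinomialSums ℤ.+-*-isCommutativeSemiring

+-subsetSum : ∀ s (g : ℕ → ℕ → ℕ) → + subsetSum s g ≡ ℤΣ.subsetSum s (λ i j → + g i j)
+-subsetSum zero    g = refl
+-subsetSum (suc s) g = trans (ℤ.pos-+ (subsetSum s (λ i j → g i (suc j))) (subsetSum s (λ i j → g (suc i) j)))
                              (cong₂ ℤ._+_ (+-subsetSum s _) (+-subsetSum s _))

+-sumUpTo : ∀ k (f : ℕ → ℕ) → + sumUpTo k f ≡ ℤΣ.sumUpTo k (λ l → + f l)
+-sumUpTo zero    f = refl
+-sumUpTo (suc k) f = trans (ℤ.pos-+ (sumUpTo k f) (f (suc k))) (cong (ℤ._+ + f (suc k)) (+-sumUpTo k f))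

+-^ : ∀ x s → + (x ^ s) ≡ (+ x) ℤΣ.^ s
+-^ x zero    = refl
+-^ x (suc s) = trans (ℤ.pos-* x _) (cong (+ x ℤ.*_) (+-^ x s))

^-ℤΣ : ∀ x n → x ℤΣ.^ n ≡ x ℤ.^ n
^-ℤΣ x zero    = refl
^-ℤΣ x (suc n) = cong (x ℤ.*_) (^-ℤΣ x n)

×-ℤΣ : ∀ n x → n ℤΣ.× x ≡ + n ℤ.* x
×-ℤΣ zero    x = sym (ℤ.*-zeroˡ x)
×-ℤΣ (suc n) x = trans (cong (ℤ._+_ x) (×-ℤΣ n x)) (sym (ℤ.suc-* (+ n) x))

sumUpTo≡sumToℤ : ∀ n f → ℤΣ.sumUpTo n f ≡ sumToℤ n f
sumUpTo≡sumToℤ zero    f = refl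
sumUpTo≡sumToℤ (suc n) f = cong (ℤ._+ f (suc n)) (sumUpTo≡sumToℤ n f)

shiftedPowerSum : ℕ → ℕ → ℤ
shiftedPowerSum k b = ℤΣ.sumUpTo k (λ l → + S k l ℤ.* (+ l - + 1) ℤ.^ b)

-- l ^ s = ((l - 1) + 1) ^ s, expanded by the binomial theorem.
^-shift : ∀ l s → (+ l) ℤΣ.^ s ≡ ℤΣ.subsetSum s (λ _ b → (+ l - + 1) ℤ.^ b)
^-shift l s = begin
  (+ l) ℤΣ.^ s
    ≡⟨ cong (ℤΣ._^ s) (sym (trans (ℤ.+-minus-telescope (+ l) (+ 1) (+ 0)) (ℤ.+-identityʳ (+ l)))) ⟩
  ((+ l - + 1) ℤ.+ + 1) ℤΣ.^ s
    ≡⟨ ℤΣ.subsetSum-^ s (+ l - + 1) ⟨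
  ℤΣ.subsetSum s (λ _ b → (+ l - + 1) ℤΣ.^ b)
    ≡⟨ ℤΣ.subsetSum-cong s (λ _ b → ^-ℤΣ (+ l - + 1) b) ⟩
  ℤΣ.subsetSum s (λ _ b → (+ l - + 1) ℤ.^ b) ∎

stirlingPowerSum-shifted : ∀ k s → + stirlingPowerSum k s ≡ ℤΣ.subsetSum s (λ _ b → shiftedPowerSum k b)
stirlingPowerSum-shifted k s = begin
  + sumUpTo k (λ l → S k l * l ^ s)
    ≡⟨ +-sumUpTo k _ ⟩
  ℤΣ.sumUpTo k (λ l → + (S k l * l ^ s))
    ≡⟨ ℤΣ.sumUpTo-cong k (λ l → trans (ℤ.pos-* (S k l) _)
                                       (cong (+ S k l ℤ.*_) (trans (+-^ l s) (^-shift l s)))) ⟩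
  ℤΣ.sumUpTo k (λ l → + S k l ℤ.* ℤΣ.subsetSum s (λ _ b → (+ l - + 1) ℤ.^ b))
    ≡⟨ ℤΣ.sumUpTo-cong k (λ l → sym (ℤΣ.subsetSum-* s (+ S k l) _)) ⟩
  ℤΣ.sumUpTo k (λ l → ℤΣ.subsetSum s (λ _ b → + S k l ℤ.* (+ l - + 1) ℤ.^ b))
    ≡⟨ ℤΣ.subsetSum-sumUpTo s k _ ⟨
  ℤΣ.subsetSum s (λ _ b → shiftedPowerSum k b) ∎

A′-shifted : ∀ k n → + A′ k n ≡ ℤΣ.subsetSum n (λ r s → + Bell r ℤ.* shiftedPowerSum k s)
A′-shifted k n = begin
  + subsetSum n (λ r s → V r * stirlingPowerSum k s)
    ≡⟨ +-subsetSum n _ ⟩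
  ℤΣ.subsetSum n (λ r s → + (V r * stirlingPowerSum k s))
    ≡⟨ ℤΣ.subsetSum-cong n (λ r s → trans (ℤ.pos-* (V r) _)
                                           (cong (+ V r ℤ.*_) (stirlingPowerSum-shifted k s))) ⟩
  ℤΣ.subsetSum n (λ r s → + V r ℤ.* ℤΣ.subsetSum s (λ _ b → P b))
    ≡⟨ ℤΣ.subsetSum-cong n (λ r s → sym (ℤΣ.subsetSum-* s (+ V r) _)) ⟩
  ℤΣ.subsetSum n (λ r s → ℤΣ.subsetSum s (λ _ b → + V r ℤ.* P b))
    ≡⟨ ℤΣ.subsetSum-assoc n (λ r _ b → + V r ℤ.* P b) ⟨
  ℤΣ.subsetSum n (λ x b → ℤΣ.subsetSum x (λ r _ → + V r ℤ.* P b))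
    ≡⟨ ℤΣ.subsetSum-cong n (λ x b → sym (ℤΣ.subsetSum-*ʳ x (λ r _ → + V r) (P b))) ⟩
  ℤΣ.subsetSum n (λ x b → ℤΣ.subsetSum x (λ r _ → + V r) ℤ.* P b)
    ≡⟨ ℤΣ.subsetSum-cong n (λ x b → cong (ℤ._* P b)
                                           (sym (trans (cong +_ (Bell≡subsetSum-V x)) (+-subsetSum x _)))) ⟩
  ℤΣ.subsetSum n (λ x b → + Bell x ℤ.* P b) ∎
  where
  P = shiftedPowerSum k

A≡binomialSum-Bell : ∀ n k → + A (n + k) k ≡ sumToℤ n (λ r → sumToℤ k (λ j →
                       + ((n C r) * Bell r * S k j) ℤ.* (+ j - + 1) ℤ.^ (n ∸ r)))
A≡binomialSum-Bell n k = begin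
  + A (n + k) k
    ≡⟨ cong +_ (A≡A′ n k) ⟩
  + A′ k n
    ≡⟨ A′-shifted k n ⟩
  ℤΣ.subsetSum n (λ r s → + Bell r ℤ.* shiftedPowerSum k s)
    ≡⟨ ℤΣ.subsetSum≡binomialSum n _ ⟩
  ℤΣ.sumUpTo n (λ r → (n C r) ℤΣ.× (+ Bell r ℤ.* shiftedPowerSum k (n ∸ r)))
    ≡⟨ trans (ℤΣ.sumUpTo-cong n term) (sumUpTo≡sumToℤ n _) ⟩
  sumToℤ n (λ r → sumToℤ k (λ j → + ((n C r) * Bell r * S k j) ℤ.* (+ j - + 1) ℤ.^ (n ∸ r))) ∎
  where
  term : ∀ r → (n C r) ℤΣ.× (+ Bell r ℤ.* shiftedPowerSum k (n ∸ r))
             ≡ sumToℤ k (λ j → + ((n C r) * Bell r * S k j) ℤ.* (+ j - + 1) ℤ.^ (n ∸ r))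
  term r = begin
    (n C r) ℤΣ.× (+ Bell r ℤ.* shiftedPowerSum k (n ∸ r))
      ≡⟨ trans (×-ℤΣ (n C r) _) (sym (ℤ.*-assoc (+ (n C r)) (+ Bell r) _)) ⟩
    c ℤ.* shiftedPowerSum k (n ∸ r)
      ≡⟨ ℤΣ.sumUpTo-* k c _ ⟨
    ℤΣ.sumUpTo k (λ j → c ℤ.* (+ S k j ℤ.* (+ j - + 1) ℤ.^ (n ∸ r)))
      ≡⟨ ℤΣ.sumUpTo-cong k (λ j → trans (sym (ℤ.*-assoc c (+ S k j) _))
                                         (cong (ℤ._* (+ j - + 1) ℤ.^ (n ∸ r)) (coefficient j))) ⟩
    ℤΣ.sumUpTo k (λ j → + ((n C r) * Bell r * S k j) ℤ.* (+ j - + 1) ℤ.^ (n ∸ r))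
      ≡⟨ sumUpTo≡sumToℤ k _ ⟩
    sumToℤ k (λ j → + ((n C r) * Bell r * S k j) ℤ.* (+ j - + 1) ℤ.^ (n ∸ r)) ∎
    where
    c = + (n C r) ℤ.* + Bell r
    coefficient : ∀ j → c ℤ.* + S k j ≡ + ((n C r) * Bell r * S k j)
    coefficient j = sym (trans (ℤ.pos-* ((n C r) * Bell r) (S k j)) (cong (ℤ._* + S k j) (ℤ.pos-* (n C r) (Bell r))))

theorem2p7 : (n k : ℕ) →
    (A (n + k) k ≡ sumTo n (λ r → sumTo k (λ j → (n C r) * V r * S k j * j ^ (n ∸ r))))
    × (+ A (n + k) k ≡ sumToℤ n (λ r → sumToℤ k (λ j →
         + ((n C r) * Bell r * S k j) ℤ.* (+ j - + 1) ℤ.^ (n ∸ r))))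
theorem2p7 n k = A≡binomialSum-V n k , A≡binomialSum-Bell n k
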